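{- $\ker\psi\supset y\mathfrak{H}\ast y\mathfrak{H}.$
   Context: Let $\mathfrak{H}=\mathbb{Q}\langle x,y\rangle$, $z_k=yx^{k-1}$, $\mathfrak{H}^1=\mathbb{Q}+y\mathfrak{H}$. The harmonic product $\ast$ on $\mathfrak{H}^1$ is given by $1\ast u=u\ast1=u$, $z_ku\ast z_lv=z_k(u\ast z_lv)+z_l(z_ku\ast v)+z_{k+l}(u\ast v)$; $y\mathfrak{H}\ast y\mathfrak{H}$ denotes the $\mathbb{Q}$-span of $\{u\ast v\mid u,v\in y\mathfrak{H}\}$. The shuffle product $\mathbin{\sqcup\!\sqcup}$ on $\mathfrak{H}$ is given by $1\mathbin{\sqcup\!\sqcup} w=w\mathbin{\sqcup\!\sqcup} 1=w$, $au\mathbin{\sqcup\!\sqcup} bv=a(u\mathbin{\sqcup\!\sqcup} bv)+b(au\mathbin{\sqcup\!\sqcup} v)$ for letters $a,b$. For $m\ge0$, $\sigma_m\colon\mathfrak{H}^1\to\mathfrak{H}^1$ is linear with $\sigma_m(1)=\delta_{m,0}$, $\sigma_m(yw)=y(w\mathbin{\sqcup\!\sqcup} x^m)$. $S_1$ is the automorphism of $\mathfrak{H}$ with $S_1(x)=x$, $S_1(y)=x+y$; $S\colon\mathfrak{H}^1\to\mathfrak{H}^1$ is linear with $S(1)=1$, $S(yw)=yS_1(w)$; $d$ is the automorphism of $\mathfrak{H}$ with $d(x)=x$, $d(y)=-y$; $\tilde S:=S\circ d$. The linear map $\psi\colon y\mathfrak{H}\to y\mathfrak{H}$ is $\psi(z_{k_1}\cdots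 z_{k_r})=\sum_{i=0}^{r-1}z_{k_1}\cdots z_{k_i}\ast\tilde S(\sigma_1(z_{k_r}\cdots z_{k_{i+1}}))$. -}

module Defs where

open import Data.Nat using (ℕ; zero; suc; _+_)
open import Data.Rational using (ℚ; 0ℚ; 1ℚ; -_) renaming (_+_ to _+ℚ_; _*_ to _*ℚ_)
open import Data.List using (List; []; _∷_; _++_; map; concatMap; replicate; take; drop; reverse; length; foldr; upTo)
open import Data.Product using (_×_; _,_)
open import Data.Maybe using (Maybe; just; nothing)
open import Relation.Nullary using (yes; no)
open import Relation.Binary.PropositionalEquality using (_≡_; refl)
open import Relation.Binary.Definitions using (DecidableEquality)
import Data.List.Properties as LP

data Letter : Set where
  X Y : Letter

_≟L_ : DecidableEquality Letter
X ≟L X = yes refl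
X ≟L Y = no (λ ())
Y ≟L X = no (λ ())
Y ≟L Y = yes refl

Word : Set
Word = List Letter

_≟W_ : DecidableEquality Word
_≟W_ = LP.≡-dec _≟L_

-- Elements of ℌ: formal finite ℚ-linear combinations of words.
-- Two polynomials are equal iff all their coefficients agree.

Poly : Set
Poly = List (ℚ × Word)

coeff : Poly → Word → ℚ
coeff [] w = 0ℚ
coeff ((c , u) ∷ p) w with u ≟W w
... | yes _ = c +ℚ coeff p w
... | no  _ = coeff p w

IsZero : Poly → Set
IsZero p = ∀ w → coeff p w ≡ 0ℚ

zeroP : Poly
zeroP = []

oneP : Poly
oneP = (1ℚ , []) ∷ []

word : Word → Poly
word w = (1ℚ , w) ∷ []

scale : ℚ → Poly → Poly
scale a = map (λ { (c , w) → (a *ℚ c , w) })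

_⊕_ : Poly → Poly → Poly
_⊕_ = _++_

sumP : List Poly → Poly
sumP = foldr _⊕_ zeroP

lin : (Word → Poly) → Poly → Poly
lin f p = concatMap (λ { (c , w) → scale c (f w) }) p

bilin : (Word → Word → Poly) → Poly → Poly → Poly
bilin f p q = lin (λ u → lin (λ v → f u v) q) p

_·_ : Poly → Poly → Poly
_·_ = bilin (λ u v → word (u ++ v))

pre : Letter → Poly → Poly
pre l = map (λ { (c , w) → (c , l ∷ w) })

-- z-words: a word of ℌ¹ = ℚ + yℌ is uniquely z_{k₁}⋯z_{k_r}, z_k = y x^{k-1}.
-- We encode z_k by the natural number k-1.

ZWord : Set
ZWord = List ℕ

fromZ : ZWord → Word
fromZ [] = []
fromZ (n ∷ ks) = Y ∷ (replicate n X ++ fromZ ks)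

-- toZ' n w : decomposition of  x^n w  where we are inside the current z-block
toZ' : ℕ → Word → ZWord
toZ' n [] = n ∷ []
toZ' n (X ∷ w) = toZ' (suc n) w
toZ' n (Y ∷ w) = n ∷ toZ' 0 w

-- decomposition of words in ℌ¹ (nothing for words starting with x, which are not in ℌ¹)
toZ : Word → Maybe ZWord
toZ [] = just []
toZ (X ∷ w) = nothing
toZ (Y ∷ w) = just (toZ' 0 w)

harmZ : ZWord → ZWord → List ZWord
harmZ [] b = b ∷ []
harmZ (k ∷ a) [] = (k ∷ a) ∷ []
harmZ (k ∷ a) (l ∷ b) =
  map (k ∷_) (harmZ a (l ∷ b)) ++
  map (l ∷_) (harmZ (k ∷ a) b) ++
  map (suc (k + l) ∷_) (harmZ a b)   -- z_{(k+1)+(l+1)} encoded as k+l+1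

ofWords : List Word → Poly
ofWords = map (λ w → (1ℚ , w))

-- on words outside ℌ¹ (never used in the statement) we put 0
harmW : Word → Word → Poly
harmW u v with toZ u | toZ v
... | just a | just b = ofWords (map fromZ (harmZ a b))
... | _      | _      = zeroP

_∗_ : Poly → Poly → Poly
_∗_ = bilin harmW

shW : Word → Word → List Word
shW [] v = v ∷ []
shW (a ∷ u) [] = (a ∷ u) ∷ []
shW (a ∷ u) (b ∷ v) = map (a ∷_) (shW u (b ∷ v)) ++ map (b ∷_) (shW (a ∷ u) v)

_ш_ : Poly → Poly → Poly
_ш_ = bilin (λ u v → ofWords (shW u v))

σW : ℕ → Word → Poly
σW zero [] = oneP
σW (suc m) [] = zeroP
σW m (X ∷ w) = zeroP          -- outside ℌ¹, never used
σW m (Y ∷ w) = pre Y (word w ш word (replicate m X))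

σ : ℕ → Poly → Poly
σ m = lin (σW m)

S₁L : Letter → Poly
S₁L X = word (X ∷ [])
S₁L Y = word (X ∷ []) ⊕ word (Y ∷ [])

S₁W : Word → Poly
S₁W [] = oneP
S₁W (a ∷ w) = S₁L a · S₁W w

S₁ : Poly → Poly
S₁ = lin S₁W

SW : Word → Poly
SW [] = oneP
SW (X ∷ w) = zeroP            -- outside ℌ¹, never used
SW (Y ∷ w) = pre Y (S₁W w)

S : Poly → Poly
S = lin SW

signW : Word → ℚ
signW [] = 1ℚ
signW (X ∷ w) = signW w
signW (Y ∷ w) = - signW w

d : Poly → Poly
d = map (λ { (c , w) → (c *ℚ signW w , w) })

S̃ : Poly → Poly
S̃ p = S (d p)

ψZ : ZWord → Poly
ψZ ks = sumP (map (λ i → word (fromZ (take i ks)) ∗ S̃ (σ 1 (word (fromZ (reverse (drop i ks))))))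
                  (upTo (length ks)))

ψW : Word → Poly
ψW (Y ∷ w) = ψZ (toZ' 0 w)
ψW _ = zeroP                  -- outside yℌ, never used

ψ : Poly → Poly
ψ = lin ψW

-- the elements of yℌ are exactly y·a for a ∈ ℌ
yP : Poly → Poly
yP = pre Y

-- ψ is the convolution id ⋆ (S ∘ D) for the deconcatenation coproduct Δ of the quasi-shuffle Hopf
-- algebra (ℌ¹, ∗, Δ): S is its antipode (Hoffman's formula, which is S̃ read on reversed words) and
-- D(z_n) = n z_{n+1} (which is σ₁ on z-words). D is a coderivation, so ψ ⋆ id = −(id ⋆ S ⋆ D) = −D.
-- Since Δ is multiplicative for ∗, evaluating ψ ⋆ id on u ∗ v gives
--   −D(u ∗ v) = Σ ψ(u₁ ∗ v₁) ∗ (u₂ ∗ v₂)   over u = u₁u₂, v = v₁v₂.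
-- The terms with u₁ or v₁ empty add up to −Du ∗ v − u ∗ Dv, which is −D(u ∗ v) because D is a derivation
-- for ∗; the terms with u₁, v₁ nonempty and shorter than u, v vanish by induction; what remains is ψ(u ∗ v) = 0.
-- Elements of ℌ are handled through their pairings eval P g with functionals g on words, the coefficient
-- of a word being the pairing with its indicator.

module Submission where

open import Data.Nat using (ℕ; zero; suc; _≤_; _<_; z≤n; s≤s) renaming (_+_ to _+ℕ_)
import Data.Nat.Properties as ℕ
open import Data.Rational using (ℚ; 0ℚ; 1ℚ; -_; _+_; _*_)
open import Data.Rational.Properties
  using (_≟_; +-*-commutativeRing; +-identityˡ; +-identityʳ; +-assoc; +-comm; +-inverseˡ;
         *-identityˡ; *-identityʳ; *-zeroʳ; *-assoc; *-distribˡ-+; neg-distrib-+; +-0-group)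
open import Algebra.Properties.Group +-0-group using (identityˡ-unique; inverseˡ-unique)
open import Data.List using (List; []; _∷_; _++_; map; reverse; length; replicate; take; drop; upTo)
import Data.List.Properties as List
open import Data.Product using (_×_; _,_; Σ-syntax)
open import Data.Maybe using (just)
open import Function using (_∘_; id)
open import Relation.Binary.PropositionalEquality
open import Relation.Nullary using (yes; no)
open import Relation.Nullary.Decidable using (dec⇒maybe)
open import Tactic.RingSolver using (solve-∀)
open import Tactic.RingSolver.Core.AlmostCommutativeRing using (AlmostCommutativeRing; fromCommutativeRing)
open import Defs

open ≡-Reasoning

ℚ-ring : AlmostCommutativeRing _ _
ℚ-ring = fromCommutativeRing +-*-commutativeRing (λ x → dec⇒maybe (0ℚ ≟ x))

private variable A B : Set

∑ : List A → (A → ℚ) → ℚ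
∑ [] f = 0ℚ
∑ (x ∷ xs) f = f x + ∑ xs f

∑-[_] : (x : A) (f : A → ℚ) → ∑ (x ∷ []) f ≡ f x
∑-[ x ] f = +-identityʳ (f x)

∑-++ : (xs ys : List A) (f : A → ℚ) → ∑ (xs ++ ys) f ≡ ∑ xs f + ∑ ys f
∑-++ [] ys f = sym (+-identityˡ _)
∑-++ (x ∷ xs) ys f = trans (cong (f x +_) (∑-++ xs ys f)) (sym (+-assoc (f x) (∑ xs f) (∑ ys f)))

∑-map : (h : A → B) (xs : List A) (f : B → ℚ) → ∑ (map h xs) f ≡ ∑ xs (f ∘ h)
∑-map h [] f = refl
∑-map h (x ∷ xs) f = cong (f (h x) +_) (∑-map h xs f)

∑-cong : (xs : List A) {f g : A → ℚ} → (∀ x → f x ≡ g x) → ∑ xs f ≡ ∑ xs g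
∑-cong [] e = refl
∑-cong (x ∷ xs) e = cong₂ _+_ (e x) (∑-cong xs e)

+-interchange : ∀ a b c d → (a + b) + (c + d) ≡ (a + c) + (b + d)
+-interchange = solve-∀ ℚ-ring

∑-+ : (xs : List A) (f g : A → ℚ) → ∑ xs (λ x → f x + g x) ≡ ∑ xs f + ∑ xs g
∑-+ [] f g = sym (+-identityˡ _)
∑-+ (x ∷ xs) f g = trans (cong (f x + g x +_) (∑-+ xs f g)) (+-interchange (f x) (g x) (∑ xs f) (∑ xs g))

∑-+₃ : (xs : List A) (f g h : A → ℚ) → ∑ xs (λ x → f x + (g x + h x)) ≡ ∑ xs f + (∑ xs g + ∑ xs h)
∑-+₃ xs f g h = trans (∑-+ xs f (λ x → g x + h x)) (cong (∑ xs f +_) (∑-+ xs g h))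

∑-* : (xs : List A) (c : ℚ) (f : A → ℚ) → ∑ xs (λ x → c * f x) ≡ c * ∑ xs f
∑-* [] c f = sym (*-zeroʳ c)
∑-* (x ∷ xs) c f = trans (cong (c * f x +_) (∑-* xs c f)) (sym (*-distribˡ-+ c (f x) (∑ xs f)))

∑-zero : (xs : List A) → ∑ xs (λ _ → 0ℚ) ≡ 0ℚ
∑-zero [] = refl
∑-zero (x ∷ xs) = trans (+-identityˡ _) (∑-zero xs)

∑-vanish : (xs : List A) {f : A → ℚ} → (∀ x → f x ≡ 0ℚ) → ∑ xs f ≡ 0ℚ
∑-vanish xs e = trans (∑-cong xs e) (∑-zero xs)

∑-neg : (xs : List A) (f : A → ℚ) → ∑ xs (λ x → - f x) ≡ - ∑ xs f
∑-neg [] f = refl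
∑-neg (x ∷ xs) f = trans (cong (- f x +_) (∑-neg xs f)) (sym (neg-distrib-+ (f x) (∑ xs f)))

∑-swap : (xs : List A) (ys : List B) (f : A → B → ℚ) →
         ∑ xs (λ x → ∑ ys (f x)) ≡ ∑ ys (λ y → ∑ xs (λ x → f x y))
∑-swap [] ys f = sym (∑-zero ys)
∑-swap (x ∷ xs) ys f =
  trans (cong (∑ ys (f x) +_) (∑-swap xs ys f)) (sym (∑-+ ys (f x) (λ y → ∑ xs (λ x′ → f x′ y))))

eval : List (ℚ × A) → (A → ℚ) → ℚ
eval [] g = 0ℚ
eval ((c , x) ∷ P) g = c * g x + eval P g

eval-++ : (P Q : List (ℚ × A)) (g : A → ℚ) → eval (P ++ Q) g ≡ eval P g + eval Q g
eval-++ [] Q g = sym (+-identityˡ _)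
eval-++ ((c , x) ∷ P) Q g = trans (cong (c * g x +_) (eval-++ P Q g)) (sym (+-assoc (c * g x) (eval P g) (eval Q g)))

eval-cong : (P : List (ℚ × A)) {f g : A → ℚ} → (∀ x → f x ≡ g x) → eval P f ≡ eval P g
eval-cong [] e = refl
eval-cong ((c , x) ∷ P) e = cong₂ _+_ (cong (c *_) (e x)) (eval-cong P e)

eval-+ : (P : List (ℚ × A)) (f g : A → ℚ) → eval P (λ x → f x + g x) ≡ eval P f + eval P g
eval-+ [] f g = sym (+-identityˡ _)
eval-+ ((c , x) ∷ P) f g =
  trans (cong₂ _+_ (*-distribˡ-+ c (f x) (g x)) (eval-+ P f g)) (+-interchange (c * f x) (c * g x) (eval P f) (eval P g))

eval-+₃ : (P : List (ℚ × A)) (f g h : A → ℚ) → eval P (λ x → f x + (g x + h x)) ≡ eval P f + (eval P g + eval P h)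
eval-+₃ P f g h = trans (eval-+ P f (λ x → g x + h x)) (cong (eval P f +_) (eval-+ P g h))

eval-* : (P : List (ℚ × A)) (a : ℚ) (f : A → ℚ) → eval P (λ x → a * f x) ≡ a * eval P f
eval-* [] a f = sym (*-zeroʳ a)
eval-* ((c , x) ∷ P) a f = trans (cong₂ _+_ (*-left-comm c a (f x)) (eval-* P a f)) (sym (*-distribˡ-+ a (c * f x) (eval P f)))
  where *-left-comm : ∀ a b e → a * (b * e) ≡ b * (a * e)
        *-left-comm = solve-∀ ℚ-ring

eval-zero : (P : List (ℚ × A)) → eval P (λ _ → 0ℚ) ≡ 0ℚ
eval-zero [] = refl
eval-zero ((c , x) ∷ P) = trans (cong₂ _+_ (*-zeroʳ c) (eval-zero P)) (+-identityˡ _)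

eval-vanish : (P : List (ℚ × A)) {f : A → ℚ} → (∀ x → f x ≡ 0ℚ) → eval P f ≡ 0ℚ
eval-vanish P e = trans (eval-cong P e) (eval-zero P)

eval-∑ : (P : List (ℚ × A)) (ys : List B) (f : A → B → ℚ) →
         eval P (λ x → ∑ ys (f x)) ≡ ∑ ys (λ y → eval P (λ x → f x y))
eval-∑ [] ys f = sym (∑-zero ys)
eval-∑ ((c , x) ∷ P) ys f =
  trans (cong₂ _+_ (sym (∑-* ys c (f x))) (eval-∑ P ys f)) (sym (∑-+ ys (λ y → c * f x y) (λ y → eval P (λ x′ → f x′ y))))

eval-swap : (P : List (ℚ × A)) (Q : List (ℚ × B)) (f : A → B → ℚ) →
            eval P (λ x → eval Q (f x)) ≡ eval Q (λ y → eval P (λ x → f x y))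
eval-swap [] Q f = sym (eval-zero Q)
eval-swap ((c , x) ∷ P) Q f =
  trans (cong₂ _+_ (sym (eval-* Q c (f x))) (eval-swap P Q f)) (sym (eval-+ Q (λ y → c * f x y) (λ y → eval P (λ x′ → f x′ y))))

mapBasis : (A → B) → List (ℚ × A) → List (ℚ × B)
mapBasis h = map (λ { (c , x) → (c , h x) })

eval-mapBasis : (h : A → B) (P : List (ℚ × A)) (g : B → ℚ) → eval (mapBasis h P) g ≡ eval P (g ∘ h)
eval-mapBasis h [] g = refl
eval-mapBasis h ((c , x) ∷ P) g = cong (c * g (h x) +_) (eval-mapBasis h P g)

eval-withCoeff : (c : ℚ) (xs : List A) (g : A → ℚ) → eval (map (c ,_) xs) g ≡ c * ∑ xs g
eval-withCoeff c [] g = sym (*-zeroʳ c)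
eval-withCoeff c (x ∷ xs) g = trans (cong (c * g x +_) (eval-withCoeff c xs g)) (sym (*-distribˡ-+ c (g x) (∑ xs g)))

-- In the encoding of Defs (z_{k+1} ↦ k), z_{k+1} ∗ z_{l+1} produces the letter k ⊞ l.
_⊞_ : ℕ → ℕ → ℕ
k ⊞ l = suc (k +ℕ l)

⊞-comm : ∀ k l → k ⊞ l ≡ l ⊞ k
⊞-comm k l = cong suc (ℕ.+-comm k l)

⊞-assoc : ∀ k l m → (k ⊞ l) ⊞ m ≡ k ⊞ (l ⊞ m)
⊞-assoc k l m = cong suc (trans (cong suc (ℕ.+-assoc k l m)) (sym (ℕ.+-suc k (l +ℕ m))))

harm : (ZWord → ℚ) → ZWord → ZWord → ℚ
harm g u v = ∑ (harmZ u v) g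

harmZ-identityʳ : ∀ u → harmZ u [] ≡ u ∷ []
harmZ-identityʳ [] = refl
harmZ-identityʳ (k ∷ u) = refl

harm-identityˡ : ∀ g v → harm g [] v ≡ g v
harm-identityˡ g v = ∑-[ v ] g

harm-identityʳ : ∀ g u → harm g u [] ≡ g u
harm-identityʳ g u = trans (cong (λ L → ∑ L g) (harmZ-identityʳ u)) (∑-[ u ] g)

harm-cons : ∀ k a l b (g : ZWord → ℚ) → harm g (k ∷ a) (l ∷ b) ≡
  harm (g ∘ (k ∷_)) a (l ∷ b) + (harm (g ∘ (l ∷_)) (k ∷ a) b + harm (g ∘ ((k ⊞ l) ∷_)) a b)
harm-cons k a l b g =
  trans (∑-++ (map (k ∷_) (harmZ a (l ∷ b))) _ g)
    (cong₂ _+_ (∑-map (k ∷_) (harmZ a (l ∷ b)) g)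
      (trans (∑-++ (map (l ∷_) (harmZ (k ∷ a) b)) _ g)
        (cong₂ _+_ (∑-map (l ∷_) (harmZ (k ∷ a) b) g) (∑-map ((k ⊞ l) ∷_) (harmZ a b) g))))

harm-cong : ∀ u v {g h : ZWord → ℚ} → (∀ x → g x ≡ h x) → harm g u v ≡ harm h u v
harm-cong u v = ∑-cong (harmZ u v)

harm-comm : ∀ g u v → harm g u v ≡ harm g v u
harm-comm g [] v = trans (harm-identityˡ g v) (sym (harm-identityʳ g v))
harm-comm g (k ∷ a) [] = refl
harm-comm g (k ∷ a) (l ∷ b) = begin
  harm g (k ∷ a) (l ∷ b)
    ≡⟨ harm-cons k a l b g ⟩
  harm (g ∘ (k ∷_)) a (l ∷ b) + (harm (g ∘ (l ∷_)) (k ∷ a) b + harm (g ∘ ((k ⊞ l) ∷_)) a b)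
    ≡⟨ cong₂ _+_ (harm-comm _ a (l ∷ b)) (cong₂ _+_ (harm-comm _ (k ∷ a) b) (harm-comm _ a b)) ⟩
  harm (g ∘ (k ∷_)) (l ∷ b) a + (harm (g ∘ (l ∷_)) b (k ∷ a) + harm (g ∘ ((k ⊞ l) ∷_)) b a)
    ≡⟨ +-left-comm (harm (g ∘ (k ∷_)) (l ∷ b) a) (harm (g ∘ (l ∷_)) b (k ∷ a)) _ ⟩
  harm (g ∘ (l ∷_)) b (k ∷ a) + (harm (g ∘ (k ∷_)) (l ∷ b) a + harm (g ∘ ((k ⊞ l) ∷_)) b a)
    ≡⟨ cong (λ j → harm (g ∘ (l ∷_)) b (k ∷ a) + (harm (g ∘ (k ∷_)) (l ∷ b) a + harm (g ∘ (j ∷_)) b a)) (⊞-comm k l) ⟩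
  harm (g ∘ (l ∷_)) b (k ∷ a) + (harm (g ∘ (k ∷_)) (l ∷ b) a + harm (g ∘ ((l ⊞ k) ∷_)) b a)
    ≡⟨ harm-cons l b k a g ⟨
  harm g (l ∷ b) (k ∷ a) ∎
  where +-left-comm : ∀ x y z → x + (y + z) ≡ y + (x + z)
        +-left-comm = solve-∀ ℚ-ring

harm₃ˡ harm₃ʳ : (ZWord → ℚ) → ZWord → ZWord → ZWord → ℚ
harm₃ˡ g u v w = ∑ (harmZ u v) (λ x → harm g x w)
harm₃ʳ g u v w = ∑ (harmZ v w) (harm g u)

-- Expanding the first letters of all three factors gives seven terms.
assocTerms : ((ZWord → ℚ) → ZWord → ZWord → ZWord → ℚ) →
             (ZWord → ℚ) → ℕ → ZWord → ℕ → ZWord → ℕ → ZWord → ℚ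
assocTerms T g k a l b m c =
  T (g ∘ (k ∷_)) a (l ∷ b) (m ∷ c) + (T (g ∘ (l ∷_)) (k ∷ a) b (m ∷ c) + (T (g ∘ ((k ⊞ l) ∷_)) a b (m ∷ c) +
  (T (g ∘ (m ∷_)) (k ∷ a) (l ∷ b) c + (T (g ∘ ((k ⊞ m) ∷_)) a (l ∷ b) c +
  (T (g ∘ ((l ⊞ m) ∷_)) (k ∷ a) b c + T (g ∘ ((k ⊞ (l ⊞ m)) ∷_)) a b c)))))

harm₃ˡ-expand : ∀ g k a l b m c → harm₃ˡ g (k ∷ a) (l ∷ b) (m ∷ c) ≡ assocTerms harm₃ˡ g k a l b m c
harm₃ˡ-expand g k a l b m c = begin
  harm₃ˡ g u v w
    ≡⟨ harm-cons k a l b (λ x → harm g x w) ⟩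
  ∑ (harmZ a v) (λ x → harm g (k ∷ x) w) +
    (∑ (harmZ u b) (λ x → harm g (l ∷ x) w) + ∑ (harmZ a b) (λ x → harm g ((k ⊞ l) ∷ x) w))
    ≡⟨ cong₂ _+_ (split k (harmZ a v)) (cong₂ _+_ (split l (harmZ u b)) (split (k ⊞ l) (harmZ a b))) ⟩
  (n₁ + (m₁ + n₂)) + ((n₃ + (m₂ + n₄)) + (n₅ + (m₃ + n₆)))
    ≡⟨ regroup n₁ m₁ n₂ n₃ m₂ n₄ n₅ m₃ n₆ ⟩
  n₁ + (n₃ + (n₅ + ((m₁ + (m₂ + m₃)) + (n₂ + (n₄ + n₆)))))
    ≡⟨ cong (λ t → n₁ + (n₃ + (n₅ + (t + (n₂ + (n₄ + n₆)))))) (harm-cons k a l b (λ x → harm (g ∘ (m ∷_)) x c)) ⟨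
  n₁ + (n₃ + (n₅ + (harm₃ˡ (g ∘ (m ∷_)) u v c + (n₂ + (n₄ + n₆)))))
    ≡⟨ cong (λ j → n₁ + (n₃ + (n₅ + (harm₃ˡ (g ∘ (m ∷_)) u v c + (n₂ + (n₄ + harm₃ˡ (g ∘ (j ∷_)) a b c))))))
            (⊞-assoc k l m) ⟩
  assocTerms harm₃ˡ g k a l b m c ∎
  where
  u v w : ZWord
  u = k ∷ a
  v = l ∷ b
  w = m ∷ c
  split : ∀ j L → ∑ L (λ x → harm g (j ∷ x) w) ≡ ∑ L (λ x → harm (g ∘ (j ∷_)) x w) +
            (∑ L (λ x → harm (g ∘ (m ∷_)) (j ∷ x) c) + ∑ L (λ x → harm (g ∘ ((j ⊞ m) ∷_)) x c))
  split j L = trans (∑-cong L (λ x → harm-cons j x m c g)) (∑-+₃ L _ _ _)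
  n₁ n₂ n₃ n₄ n₅ n₆ m₁ m₂ m₃ : ℚ
  n₁ = harm₃ˡ (g ∘ (k ∷_)) a v w
  n₂ = harm₃ˡ (g ∘ ((k ⊞ m) ∷_)) a v c
  n₃ = harm₃ˡ (g ∘ (l ∷_)) u b w
  n₄ = harm₃ˡ (g ∘ ((l ⊞ m) ∷_)) u b c
  n₅ = harm₃ˡ (g ∘ ((k ⊞ l) ∷_)) a b w
  n₆ = harm₃ˡ (g ∘ (((k ⊞ l) ⊞ m) ∷_)) a b c
  m₁ = ∑ (harmZ a v) (λ x → harm (g ∘ (m ∷_)) (k ∷ x) c)
  m₂ = ∑ (harmZ u b) (λ x → harm (g ∘ (m ∷_)) (l ∷ x) c)
  m₃ = ∑ (harmZ a b) (λ x → harm (g ∘ (m ∷_)) ((k ⊞ l) ∷ x) c)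
  regroup : ∀ a₁ a₂ a₃ a₄ a₅ a₆ a₇ a₈ a₉ → (a₁ + (a₂ + a₃)) + ((a₄ + (a₅ + a₆)) + (a₇ + (a₈ + a₉))) ≡
            a₁ + (a₄ + (a₇ + ((a₂ + (a₅ + a₈)) + (a₃ + (a₆ + a₉)))))
  regroup = solve-∀ ℚ-ring

harm₃ʳ-expand : ∀ g k a l b m c → harm₃ʳ g (k ∷ a) (l ∷ b) (m ∷ c) ≡ assocTerms harm₃ʳ g k a l b m c
harm₃ʳ-expand g k a l b m c = begin
  harm₃ʳ g u v w
    ≡⟨ harm-cons l b m c (harm g u) ⟩
  ∑ (harmZ b w) (λ y → harm g u (l ∷ y)) +
    (∑ (harmZ v c) (λ y → harm g u (m ∷ y)) + ∑ (harmZ b c) (λ y → harm g u ((l ⊞ m) ∷ y)))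
    ≡⟨ cong₂ _+_ (split l (harmZ b w)) (cong₂ _+_ (split m (harmZ v c)) (split (l ⊞ m) (harmZ b c))) ⟩
  (r₁ + (t₁ + t₂)) + ((r₂ + (t₃ + t₄)) + (r₃ + (t₅ + t₆)))
    ≡⟨ regroup r₁ t₁ t₂ r₂ t₃ t₄ r₃ t₅ t₆ ⟩
  (r₁ + (r₂ + r₃)) + (t₁ + (t₂ + (t₃ + (t₄ + (t₅ + t₆)))))
    ≡⟨ cong (_+ (t₁ + (t₂ + (t₃ + (t₄ + (t₅ + t₆)))))) (harm-cons l b m c (harm (g ∘ (k ∷_)) a)) ⟨
  assocTerms harm₃ʳ g k a l b m c ∎
  where
  u v w : ZWord
  u = k ∷ a
  v = l ∷ b
  w = m ∷ c
  split : ∀ j L → ∑ L (λ y → harm g u (j ∷ y)) ≡ ∑ L (λ y → harm (g ∘ (k ∷_)) a (j ∷ y)) +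
            (∑ L (λ y → harm (g ∘ (j ∷_)) u y) + ∑ L (λ y → harm (g ∘ ((k ⊞ j) ∷_)) a y))
  split j L = trans (∑-cong L (λ y → harm-cons k a j y g)) (∑-+₃ L _ _ _)
  r₁ r₂ r₃ t₁ t₂ t₃ t₄ t₅ t₆ : ℚ
  r₁ = ∑ (harmZ b w) (λ y → harm (g ∘ (k ∷_)) a (l ∷ y))
  r₂ = ∑ (harmZ v c) (λ y → harm (g ∘ (k ∷_)) a (m ∷ y))
  r₃ = ∑ (harmZ b c) (λ y → harm (g ∘ (k ∷_)) a ((l ⊞ m) ∷ y))
  t₁ = harm₃ʳ (g ∘ (l ∷_)) u b w
  t₂ = harm₃ʳ (g ∘ ((k ⊞ l) ∷_)) a b w
  t₃ = harm₃ʳ (g ∘ (m ∷_)) u v c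
  t₄ = harm₃ʳ (g ∘ ((k ⊞ m) ∷_)) a v c
  t₅ = harm₃ʳ (g ∘ ((l ⊞ m) ∷_)) u b c
  t₆ = harm₃ʳ (g ∘ ((k ⊞ (l ⊞ m)) ∷_)) a b c
  regroup : ∀ a₁ a₂ a₃ a₄ a₅ a₆ a₇ a₈ a₉ → (a₁ + (a₂ + a₃)) + ((a₄ + (a₅ + a₆)) + (a₇ + (a₈ + a₉))) ≡
            (a₁ + (a₄ + a₇)) + (a₂ + (a₃ + (a₅ + (a₆ + (a₈ + a₉)))))
  regroup = solve-∀ ℚ-ring

harm-assoc : ∀ g u v w → harm₃ˡ g u v w ≡ harm₃ʳ g u v w
harm-assoc g [] v w = trans (∑-[ v ] (λ x → harm g x w)) (∑-cong (harmZ v w) (λ y → sym (harm-identityˡ g y)))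
harm-assoc g (k ∷ a) [] w = trans (∑-[ k ∷ a ] (λ x → harm g x w)) (sym (∑-[ w ] (harm g (k ∷ a))))
harm-assoc g (k ∷ a) (l ∷ b) [] =
  trans (∑-cong (harmZ (k ∷ a) (l ∷ b)) (harm-identityʳ g)) (sym (∑-[ l ∷ b ] (harm g (k ∷ a))))
harm-assoc g (k ∷ a) (l ∷ b) (m ∷ c) = begin
  harm₃ˡ g (k ∷ a) (l ∷ b) (m ∷ c)    ≡⟨ harm₃ˡ-expand g k a l b m c ⟩
  assocTerms harm₃ˡ g k a l b m c
    ≡⟨ cong₂ _+_ (harm-assoc _ a (l ∷ b) (m ∷ c)) (cong₂ _+_ (harm-assoc _ (k ∷ a) b (m ∷ c))
         (cong₂ _+_ (harm-assoc _ a b (m ∷ c)) (cong₂ _+_ (harm-assoc _ (k ∷ a) (l ∷ b) c)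
         (cong₂ _+_ (harm-assoc _ a (l ∷ b) c) (cong₂ _+_ (harm-assoc _ (k ∷ a) b c) (harm-assoc _ a b c)))))) ⟩
  assocTerms harm₃ʳ g k a l b m c     ≡⟨ harm₃ʳ-expand g k a l b m c ⟨
  harm₃ʳ g (k ∷ a) (l ∷ b) (m ∷ c)    ∎

splits : ZWord → List (ZWord × ZWord)
splits [] = ([] , []) ∷ []
splits (k ∷ w) = ([] , k ∷ w) ∷ map (λ { (p , q) → (k ∷ p , q) }) (splits w)

Δ : ZWord → (ZWord → ZWord → ℚ) → ℚ
Δ w F = ∑ (splits w) (λ { (p , q) → F p q })

Δ-nil : ∀ F → Δ [] F ≡ F [] []
Δ-nil F = +-identityʳ _

Δ-cons : ∀ k w F → Δ (k ∷ w) F ≡ F [] (k ∷ w) + Δ w (F ∘ (k ∷_))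
Δ-cons k w F = cong (F [] (k ∷ w) +_) (∑-map _ (splits w) _)

Δ-cong : ∀ w {F G : ZWord → ZWord → ℚ} → (∀ p q → F p q ≡ G p q) → Δ w F ≡ Δ w G
Δ-cong w e = ∑-cong (splits w) (λ { (p , q) → e p q })

Δ-+ : ∀ w (F G : ZWord → ZWord → ℚ) → Δ w (λ p q → F p q + G p q) ≡ Δ w F + Δ w G
Δ-+ w F G = trans (∑-cong (splits w) (λ { (p , q) → refl })) (∑-+ (splits w) _ _)

Δ-+₃ : ∀ w (F G H : ZWord → ZWord → ℚ) → Δ w (λ p q → F p q + (G p q + H p q)) ≡ Δ w F + (Δ w G + Δ w H)
Δ-+₃ w F G H = trans (Δ-+ w F _) (cong (Δ w F +_) (Δ-+ w G H))

Δ-* : ∀ w c (F : ZWord → ZWord → ℚ) → Δ w (λ p q → c * F p q) ≡ c * Δ w F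
Δ-* w c F = trans (∑-cong (splits w) (λ { (p , q) → refl })) (∑-* (splits w) c _)

Δ-neg : ∀ w (F : ZWord → ZWord → ℚ) → Δ w (λ p q → - F p q) ≡ - Δ w F
Δ-neg w F = trans (∑-cong (splits w) (λ { (p , q) → refl })) (∑-neg (splits w) _)

Δ-eval : ∀ w (P : List (ℚ × A)) (f : ZWord → ZWord → A → ℚ) →
         Δ w (λ p q → eval P (f p q)) ≡ eval P (λ x → Δ w (λ p q → f p q x))
Δ-eval w P f = trans (∑-cong (splits w) (λ { (p , q) → refl })) (sym (eval-∑ P (splits w) _))

-- ⟨Δu ∗ Δv, G⟩, the harmonic product taken factorwise in ℌ¹ ⊗ ℌ¹
harm⊗ : (ZWord → ZWord → ℚ) → ZWord → ZWord → ℚ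
harm⊗ G u v = Δ u λ u₁ u₂ → Δ v λ v₁ v₂ → ∑ (harmZ u₁ v₁) λ p → harm (G p) u₂ v₂

Δ∘harm-expand : ∀ G k a l b → ∑ (harmZ (k ∷ a) (l ∷ b)) (λ x → Δ x G) ≡
  harm (G []) (k ∷ a) (l ∷ b) + (∑ (harmZ a (l ∷ b)) (λ x → Δ x (G ∘ (k ∷_))) +
    (∑ (harmZ (k ∷ a) b) (λ x → Δ x (G ∘ (l ∷_))) + ∑ (harmZ a b) (λ x → Δ x (G ∘ ((k ⊞ l) ∷_)))))
Δ∘harm-expand G k a l b =
  trans (harm-cons k a l b (λ x → Δ x G))
    (trans (cong₂ _+_ (split k (harmZ a (l ∷ b))) (cong₂ _+_ (split l (harmZ (k ∷ a) b)) (split (k ⊞ l) (harmZ a b))))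
      (trans (regroup e₁ d₁ e₂ d₂ e₃ d₃) (cong (_+ (d₁ + (d₂ + d₃))) (sym (harm-cons k a l b (G []))))))
  where
  split : ∀ j L → ∑ L (λ x → Δ (j ∷ x) G) ≡ ∑ L (λ x → G [] (j ∷ x)) + ∑ L (λ x → Δ x (G ∘ (j ∷_)))
  split j L = trans (∑-cong L (λ x → Δ-cons j x G)) (∑-+ L (λ x → G [] (j ∷ x)) (λ x → Δ x (G ∘ (j ∷_))))
  e₁ e₂ e₃ d₁ d₂ d₃ : ℚ
  e₁ = harm (G [] ∘ (k ∷_)) a (l ∷ b)
  e₂ = harm (G [] ∘ (l ∷_)) (k ∷ a) b
  e₃ = harm (G [] ∘ ((k ⊞ l) ∷_)) a b
  d₁ = ∑ (harmZ a (l ∷ b)) (λ x → Δ x (G ∘ (k ∷_)))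
  d₂ = ∑ (harmZ (k ∷ a) b) (λ x → Δ x (G ∘ (l ∷_)))
  d₃ = ∑ (harmZ a b) (λ x → Δ x (G ∘ ((k ⊞ l) ∷_)))
  regroup : ∀ x₁ x₂ x₃ x₄ x₅ x₆ → (x₁ + x₂) + ((x₃ + x₄) + (x₅ + x₆)) ≡ (x₁ + (x₃ + x₅)) + (x₂ + (x₄ + x₆))
  regroup = solve-∀ ℚ-ring

harm⊗-expand : ∀ G k a l b → harm⊗ G (k ∷ a) (l ∷ b) ≡
  harm (G []) (k ∷ a) (l ∷ b) + (harm⊗ (G ∘ (k ∷_)) a (l ∷ b) + (harm⊗ (G ∘ (l ∷_)) (k ∷ a) b + harm⊗ (G ∘ ((k ⊞ l) ∷_)) a b))
harm⊗-expand G k a l b = begin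
  harm⊗ G u v
    ≡⟨ Δ-cons k a (λ u₁ u₂ → Δ v (Φ u₁ u₂)) ⟩
  Δ v (Φ [] u) + Δ a (λ a′ u₂ → Δ v (Φ (k ∷ a′) u₂))
    ≡⟨ cong₂ _+_ row₀ (trans (Δ-cong a rowₖ) (trans (Δ-+ a Aₖ _) (cong (Δ a Aₖ +_) (Δ-+₃ a T₁ T₂ T₃)))) ⟩
  (harm (G []) u v + Δ b Bₗ) + (Δ a Aₖ + (Δ a T₁ + (Δ a T₂ + Δ a T₃)))
    ≡⟨ regroup (harm (G []) u v) (Δ b Bₗ) (Δ a Aₖ) (Δ a T₁) (Δ a T₂) (Δ a T₃) ⟩
  harm (G []) u v + ((Δ a Aₖ + Δ a T₁) + ((Δ b Bₗ + Δ a T₂) + Δ a T₃))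
    ≡⟨ cong (harm (G []) u v +_) (cong₂ _+_ (sym (Δ-+ a Aₖ T₁)) (cong (_+ Δ a T₃) (sym splitₗ))) ⟩
  harm (G []) u v + (Δ a (λ a′ u₂ → Aₖ a′ u₂ + T₁ a′ u₂) + (harm⊗ (G ∘ (l ∷_)) u b + Δ a T₃))
    ≡⟨ cong (λ t → harm (G []) u v + (t + (harm⊗ (G ∘ (l ∷_)) u b + Δ a T₃))) (Δ-cong a (λ a′ u₂ → sym (splitₖ a′ u₂))) ⟩
  harm (G []) u v + (harm⊗ (G ∘ (k ∷_)) a v + (harm⊗ (G ∘ (l ∷_)) u b + harm⊗ (G ∘ ((k ⊞ l) ∷_)) a b)) ∎
  where
  u v : ZWord
  u = k ∷ a
  v = l ∷ b
  Φ : ZWord → ZWord → ZWord → ZWord → ℚ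
  Φ u₁ u₂ v₁ v₂ = ∑ (harmZ u₁ v₁) λ p → harm (G p) u₂ v₂
  Bₗ Aₖ T₁ T₂ T₃ : ZWord → ZWord → ℚ
  Bₗ b′ v₂ = harm (G (l ∷ b′)) u v₂
  Aₖ a′ u₂ = harm (G (k ∷ a′)) u₂ v
  T₁ a′ u₂ = Δ b λ b′ v₂ → ∑ (harmZ a′ (l ∷ b′)) λ p → harm (G (k ∷ p)) u₂ v₂
  T₂ a′ u₂ = Δ b λ b′ v₂ → ∑ (harmZ (k ∷ a′) b′) λ p → harm (G (l ∷ p)) u₂ v₂
  T₃ a′ u₂ = Δ b λ b′ v₂ → ∑ (harmZ a′ b′) λ p → harm (G ((k ⊞ l) ∷ p)) u₂ v₂
  row₀ : Δ v (Φ [] u) ≡ harm (G []) u v + Δ b Bₗ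
  row₀ = trans (Δ-cons l b (Φ [] u))
    (cong₂ _+_ (∑-[ [] ] (λ p → harm (G p) u v)) (Δ-cong b (λ b′ v₂ → ∑-[ l ∷ b′ ] (λ p → harm (G p) u v₂))))
  rowₖ : ∀ a′ u₂ → Δ v (Φ (k ∷ a′) u₂) ≡ Aₖ a′ u₂ + (T₁ a′ u₂ + (T₂ a′ u₂ + T₃ a′ u₂))
  rowₖ a′ u₂ = trans (Δ-cons l b (Φ (k ∷ a′) u₂))
    (cong₂ _+_ (∑-[ k ∷ a′ ] (λ p → harm (G p) u₂ v))
      (trans (Δ-cong b (λ b′ v₂ → harm-cons k a′ l b′ (λ p → harm (G p) u₂ v₂)))
        (Δ-+₃ b (λ b′ v₂ → ∑ (harmZ a′ (l ∷ b′)) λ p → harm (G (k ∷ p)) u₂ v₂) (T₂′ a′ u₂) (T₃′ a′ u₂))))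
    where
    T₂′ T₃′ : ZWord → ZWord → ZWord → ZWord → ℚ
    T₂′ a′ u₂ b′ v₂ = ∑ (harmZ (k ∷ a′) b′) λ p → harm (G (l ∷ p)) u₂ v₂
    T₃′ a′ u₂ b′ v₂ = ∑ (harmZ a′ b′) λ p → harm (G ((k ⊞ l) ∷ p)) u₂ v₂
  splitₖ : ∀ a′ u₂ → Δ v (λ v₁ v₂ → ∑ (harmZ a′ v₁) λ p → harm (G (k ∷ p)) u₂ v₂) ≡ Aₖ a′ u₂ + T₁ a′ u₂
  splitₖ a′ u₂ = trans (Δ-cons l b (λ v₁ v₂ → ∑ (harmZ a′ v₁) λ p → harm (G (k ∷ p)) u₂ v₂))
    (cong (_+ T₁ a′ u₂) (trans (cong (λ L → ∑ L (λ p → harm (G (k ∷ p)) u₂ v)) (harmZ-identityʳ a′))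
                                (∑-[ a′ ] (λ p → harm (G (k ∷ p)) u₂ v))))
  splitₗ : harm⊗ (G ∘ (l ∷_)) u b ≡ Δ b Bₗ + Δ a T₂
  splitₗ = trans (Δ-cons k a (λ u₁ u₂ → Δ b λ v₁ v₂ → ∑ (harmZ u₁ v₁) λ p → harm (G (l ∷ p)) u₂ v₂))
    (cong (_+ Δ a T₂) (Δ-cong b (λ b′ v₂ → ∑-[ b′ ] (λ p → harm (G (l ∷ p)) u v₂))))
  regroup : ∀ x₁ x₂ x₃ x₄ x₅ x₆ → (x₁ + x₂) + (x₃ + (x₄ + (x₅ + x₆))) ≡ x₁ + ((x₃ + x₄) + ((x₂ + x₅) + x₆))
  regroup = solve-∀ ℚ-ring

Δ-harm : ∀ G u v → ∑ (harmZ u v) (λ x → Δ x G) ≡ harm⊗ G u v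
Δ-harm G [] v =
  trans (∑-[ v ] (λ x → Δ x G))
    (trans (Δ-cong v (λ v₁ v₂ → sym (trans (∑-[ v₁ ] (λ p → harm (G p) [] v₂)) (harm-identityˡ (G v₁) v₂))))
      (sym (Δ-nil (λ u₁ u₂ → Δ v λ v₁ v₂ → ∑ (harmZ u₁ v₁) λ p → harm (G p) u₂ v₂))))
Δ-harm G (k ∷ a) [] =
  trans (∑-[ k ∷ a ] (λ x → Δ x G))
    (Δ-cong (k ∷ a) (λ u₁ u₂ → sym (trans (Δ-nil (λ v₁ v₂ → ∑ (harmZ u₁ v₁) λ p → harm (G p) u₂ v₂))
      (trans (cong (λ L → ∑ L (λ p → harm (G p) u₂ [])) (harmZ-identityʳ u₁))
        (trans (∑-[ u₁ ] (λ p → harm (G p) u₂ [])) (harm-identityʳ (G u₁) u₂))))))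
Δ-harm G (k ∷ a) (l ∷ b) =
  trans (Δ∘harm-expand G k a l b)
    (trans (cong (harm (G []) (k ∷ a) (l ∷ b) +_)
             (cong₂ _+_ (Δ-harm _ a (l ∷ b)) (cong₂ _+_ (Δ-harm _ (k ∷ a) b) (Δ-harm _ a b))))
      (sym (harm⊗-expand G k a l b)))

counit : ZWord → ℚ → ℚ
counit [] x = x
counit (_ ∷ _) x = 0ℚ

counit-zero : ∀ w → counit w 0ℚ ≡ 0ℚ
counit-zero [] = refl
counit-zero (_ ∷ _) = refl

eval-counit : (P : List (ℚ × A)) (s : ZWord) (f : A → ℚ) → eval P (λ x → counit s (f x)) ≡ counit s (eval P f)
eval-counit P [] f = refl
eval-counit P (_ ∷ _) f = eval-zero P

Δ-counitʳ : ∀ w (K : ZWord → ℚ) → Δ w (λ p q → counit q (K p)) ≡ K w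
Δ-counitʳ [] K = Δ-nil (λ p q → counit q (K p))
Δ-counitʳ (k ∷ w) K = trans (Δ-cons k w (λ p q → counit q (K p))) (trans (+-identityˡ _) (Δ-counitʳ w (K ∘ (k ∷_))))

Δ-counitˡ : ∀ w (K : ZWord → ℚ) → Δ w (λ p q → counit p (K q)) ≡ K w
Δ-counitˡ [] K = Δ-nil (λ p q → counit p (K q))
Δ-counitˡ (k ∷ w) K =
  trans (Δ-cons k w (λ p q → counit p (K q)))
    (trans (cong (K (k ∷ w) +_) (trans (Δ-cong w (λ _ _ → refl)) (∑-zero (splits w)))) (+-identityʳ _))

Δ-coassoc : ∀ w (K : ZWord → ZWord → ZWord → ℚ) →
            Δ w (λ s r → Δ s (λ a b → K a b r)) ≡ Δ w (λ a s → Δ s (λ b r → K a b r))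
Δ-coassoc [] K =
  trans (Δ-nil (λ s r → Δ s (λ a b → K a b r)))
    (trans (Δ-nil (λ a b → K a b []))
      (sym (trans (Δ-nil (λ a s → Δ s (λ b r → K a b r))) (Δ-nil (λ b r → K [] b r)))))
Δ-coassoc (k ∷ w) K = begin
  Δ (k ∷ w) (λ s r → Δ s (λ a b → K a b r))
    ≡⟨ Δ-cons k w (λ s r → Δ s (λ a b → K a b r)) ⟩
  Δ [] (λ a b → K a b (k ∷ w)) + Δ w (λ s r → Δ (k ∷ s) (λ a b → K a b r))
    ≡⟨ cong₂ _+_ (Δ-nil (λ a b → K a b (k ∷ w)))
         (trans (Δ-cong w (λ s r → Δ-cons k s (λ a b → K a b r)))
                (Δ-+ w (λ s r → K [] (k ∷ s) r) (λ s r → Δ s (λ a b → K (k ∷ a) b r)))) ⟩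
  K [] [] (k ∷ w) + (Δ w (λ s r → K [] (k ∷ s) r) + Δ w (λ s r → Δ s (λ a b → K (k ∷ a) b r)))
    ≡⟨ +-assoc (K [] [] (k ∷ w)) _ _ ⟨
  (K [] [] (k ∷ w) + Δ w (λ s r → K [] (k ∷ s) r)) + Δ w (λ s r → Δ s (λ a b → K (k ∷ a) b r))
    ≡⟨ cong₂ _+_ (sym (Δ-cons k w (λ b r → K [] b r))) (Δ-coassoc w (λ a → K (k ∷ a))) ⟩
  Δ (k ∷ w) (λ b r → K [] b r) + Δ w (λ a s → Δ s (λ b r → K (k ∷ a) b r))
    ≡⟨ Δ-cons k w (λ a s → Δ s (λ b r → K a b r)) ⟨
  Δ (k ∷ w) (λ a s → Δ s (λ b r → K a b r)) ∎

Δ⁺ : ZWord → (ZWord → ZWord → ℚ) → ℚ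
Δ⁺ [] F = 0ℚ
Δ⁺ (k ∷ w) F = F [] (k ∷ w) + Δ⁺ w (F ∘ (k ∷_))

Δ-last : ∀ w F → Δ w F ≡ Δ⁺ w F + F w []
Δ-last [] F = trans (Δ-nil F) (sym (+-identityˡ _))
Δ-last (k ∷ w) F =
  trans (Δ-cons k w F)
    (trans (cong (F [] (k ∷ w) +_) (Δ-last w (F ∘ (k ∷_)))) (sym (+-assoc (F [] (k ∷ w)) _ _)))

Δ⁺-vanish : ∀ w {F : ZWord → ZWord → ℚ} → (∀ p q → length p < length w → F p q ≡ 0ℚ) → Δ⁺ w F ≡ 0ℚ
Δ⁺-vanish [] e = refl
Δ⁺-vanish (k ∷ w) e =
  trans (cong₂ _+_ (e [] (k ∷ w) (s≤s z≤n)) (Δ⁺-vanish w (λ p q lt → e (k ∷ p) q (s≤s lt)))) (+-identityˡ _)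

Δ-congˡ : ∀ w {F G : ZWord → ZWord → ℚ} → (∀ p q → length p ≤ length w → F p q ≡ G p q) → Δ w F ≡ Δ w G
Δ-congˡ [] {F} {G} e = trans (Δ-nil F) (trans (e [] [] z≤n) (sym (Δ-nil G)))
Δ-congˡ (k ∷ w) {F} {G} e =
  trans (Δ-cons k w F)
    (trans (cong₂ _+_ (e [] (k ∷ w) z≤n) (Δ-congˡ w (λ p q le → e (k ∷ p) q (s≤s le)))) (sym (Δ-cons k w G)))

Δ-congʳ : ∀ w {F G : ZWord → ZWord → ℚ} → (∀ p q → length q ≤ length w → F p q ≡ G p q) → Δ w F ≡ Δ w G
Δ-congʳ [] {F} {G} e = trans (Δ-nil F) (trans (e [] [] z≤n) (sym (Δ-nil G)))
Δ-congʳ (k ∷ w) {F} {G} e =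
  trans (Δ-cons k w F)
    (trans (cong₂ _+_ (e [] (k ∷ w) ℕ.≤-refl) (Δ-congʳ w (λ p q le → e (k ∷ p) q (ℕ.m≤n⇒m≤1+n le))))
      (sym (Δ-cons k w G)))

weight : ℕ → ℚ
weight zero = 1ℚ
weight (suc k) = 1ℚ + weight k

weight-⊞ : ∀ k l → weight (k ⊞ l) ≡ weight k + weight l
weight-⊞ zero l = refl
weight-⊞ (suc k) l = trans (cong (1ℚ +_) (weight-⊞ k l)) (sym (+-assoc 1ℚ (weight k) (weight l)))

D : ZWord → List (ℚ × ZWord)
D [] = []
D (k ∷ w) = (weight k , suc k ∷ w) ∷ mapBasis (k ∷_) (D w)

D-cons : ∀ k w g → eval (D (k ∷ w)) g ≡ weight k * g (suc k ∷ w) + eval (D w) (g ∘ (k ∷_))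
D-cons k w g = cong (weight k * g (suc k ∷ w) +_) (eval-mapBasis (k ∷_) (D w) g)

eval-D-counit : ∀ r c → eval (D r) (λ r′ → counit r′ c) ≡ 0ℚ
eval-D-counit [] c = refl
eval-D-counit (k ∷ r) c =
  trans (D-cons k r (λ r′ → counit r′ c)) (trans (cong₂ _+_ (*-zeroʳ (weight k)) (eval-zero (D r))) (+-identityˡ 0ℚ))

D-++ : ∀ xs ys g → eval (D (xs ++ ys)) g ≡ eval (D xs) (λ x → g (x ++ ys)) + eval (D ys) (λ y → g (xs ++ y))
D-++ [] ys g = sym (+-identityˡ _)
D-++ (k ∷ xs) ys g =
  trans (D-cons k (xs ++ ys) g)
    (trans (cong (weight k * g (suc k ∷ xs ++ ys) +_) (D-++ xs ys (g ∘ (k ∷_))))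
      (trans (sym (+-assoc (weight k * g (suc k ∷ xs ++ ys)) _ _))
        (cong (_+ eval (D ys) (λ y → g (k ∷ xs ++ y))) (sym (D-cons k xs (λ x → g (x ++ ys)))))))

D-reverse : ∀ q g → eval (D (reverse q)) g ≡ eval (D q) (g ∘ reverse)
D-reverse [] g = refl
D-reverse (k ∷ q) g = begin
  eval (D (reverse (k ∷ q))) g
    ≡⟨ cong (λ z → eval (D z) g) (List.unfold-reverse k q) ⟩
  eval (D (reverse q ++ k ∷ [])) g
    ≡⟨ D-++ (reverse q) (k ∷ []) g ⟩
  eval (D (reverse q)) (λ x → g (x ++ k ∷ [])) + eval (D (k ∷ [])) (λ y → g (reverse q ++ y))
    ≡⟨ cong₂ _+_ (trans (D-reverse q (λ x → g (x ++ k ∷ [])))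
                        (eval-cong (D q) (λ x → cong g (sym (List.unfold-reverse k x)))))
                 (trans (+-identityʳ _) (cong (weight k *_) (cong g (sym (List.unfold-reverse (suc k) q))))) ⟩
  eval (D q) (λ x → g (reverse (k ∷ x))) + weight k * g (reverse (suc k ∷ q))
    ≡⟨ +-comm (eval (D q) (λ x → g (reverse (k ∷ x)))) _ ⟩
  weight k * g (reverse (suc k ∷ q)) + eval (D q) (λ x → g (reverse (k ∷ x)))
    ≡⟨ D-cons k q (g ∘ reverse) ⟨
  eval (D (k ∷ q)) (g ∘ reverse) ∎

Δ-D : ∀ r (F : ZWord → ZWord → ℚ) → eval (D r) (λ r′ → Δ r′ F) ≡
      Δ r (λ b q → eval (D b) (λ b′ → F b′ q) + eval (D q) (F b))
Δ-D [] F = sym (trans (Δ-nil (λ b q → eval (D b) (λ b′ → F b′ q) + eval (D q) (F b))) (+-identityˡ 0ℚ))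
Δ-D (k ∷ r) F = begin
  eval (D (k ∷ r)) (λ r′ → Δ r′ F)
    ≡⟨ D-cons k r (λ r′ → Δ r′ F) ⟩
  weight k * Δ (suc k ∷ r) F + eval (D r) (λ t → Δ (k ∷ t) F)
    ≡⟨ cong₂ _+_ (trans (cong (weight k *_) (Δ-cons (suc k) r F)) (*-distribˡ-+ (weight k) _ _))
                 (trans (eval-cong (D r) (λ t → Δ-cons k t F))
                   (trans (eval-+ (D r) (λ t → F [] (k ∷ t)) (λ t → Δ t (F ∘ (k ∷_))))
                     (cong (eval (D r) (λ t → F [] (k ∷ t)) +_) (Δ-D r (F ∘ (k ∷_)))))) ⟩
  (x₁ + x₂) + (x₃ + x₄)
    ≡⟨ +-interchange x₁ x₂ x₃ x₄ ⟩
  (x₁ + x₃) + (x₂ + x₄)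
    ≡⟨ cong₂ _+_ (trans (sym (D-cons k r (F []))) (sym (+-identityˡ _))) (sym tail) ⟩
  G [] (k ∷ r) + Δ r (G ∘ (k ∷_))
    ≡⟨ Δ-cons k r G ⟨
  Δ (k ∷ r) G ∎
  where
  G : ZWord → ZWord → ℚ
  G b q = eval (D b) (λ b′ → F b′ q) + eval (D q) (F b)
  x₁ x₂ x₃ x₄ : ℚ
  x₁ = weight k * F [] (suc k ∷ r)
  x₂ = weight k * Δ r (λ p q → F (suc k ∷ p) q)
  x₃ = eval (D r) (λ t → F [] (k ∷ t))
  x₄ = Δ r (λ b q → eval (D b) (λ b′ → F (k ∷ b′) q) + eval (D q) (F (k ∷ b)))
  tail : Δ r (G ∘ (k ∷_)) ≡ x₂ + x₄
  tail = begin
    Δ r (G ∘ (k ∷_))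
      ≡⟨ Δ-cong r (λ b q → trans (cong (_+ eval (D q) (F (k ∷ b))) (D-cons k b (λ b′ → F b′ q)))
                                 (+-assoc (weight k * F (suc k ∷ b) q) _ _)) ⟩
    Δ r (λ b q → weight k * F (suc k ∷ b) q + (eval (D b) (λ b′ → F (k ∷ b′) q) + eval (D q) (F (k ∷ b))))
      ≡⟨ Δ-+ r (λ b q → weight k * F (suc k ∷ b) q) _ ⟩
    Δ r (λ b q → weight k * F (suc k ∷ b) q) + x₄
      ≡⟨ cong (_+ x₄) (Δ-* r (weight k) (λ b q → F (suc k ∷ b) q)) ⟩
    x₂ + x₄ ∎

Leibniz : (ZWord → ℚ) → ZWord → ZWord → Set
Leibniz g u v = ∑ (harmZ u v) (λ x → eval (D x) g) ≡ eval (D u) (λ t → harm g t v) + eval (D v) (harm g u)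

-- The common expansion of both sides of Leibniz g (k ∷ a) (l ∷ b).
module LeibnizTerms (g : ZWord → ℚ) (k : ℕ) (a : ZWord) (l : ℕ) (b : ZWord) where
  wₖ wₗ α₁ α₂ α₃ β₁ β₂ β₃ γ₁ γ₂ γ₃ δ₁ δ₂ total : ℚ
  wₖ = weight k
  wₗ = weight l
  α₁ = harm (g ∘ (suc k ∷_)) a (l ∷ b)
  α₂ = harm (g ∘ (suc l ∷_)) (k ∷ a) b
  α₃ = harm (g ∘ (suc (k ⊞ l) ∷_)) a b
  β₁ = eval (D a) (λ t → harm (g ∘ (k ∷_)) t (l ∷ b))
  β₂ = harm (g ∘ (k ∷_)) a (suc l ∷ b)
  β₃ = eval (D b) (λ t → harm (g ∘ (k ∷_)) a (l ∷ t))
  γ₁ = harm (g ∘ (l ∷_)) (suc k ∷ a) b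
  γ₂ = eval (D a) (λ t → harm (g ∘ (l ∷_)) (k ∷ t) b)
  γ₃ = eval (D b) (λ t → harm (g ∘ (l ∷_)) (k ∷ a) t)
  δ₁ = eval (D a) (λ t → harm (g ∘ ((k ⊞ l) ∷_)) t b)
  δ₂ = eval (D b) (λ t → harm (g ∘ ((k ⊞ l) ∷_)) a t)

  total = (wₖ * α₁ + (β₁ + (wₗ * β₂ + β₃))) + ((wₗ * α₂ + ((wₖ * γ₁ + γ₂) + γ₃)) + ((wₖ + wₗ) * α₃ + (δ₁ + δ₂)))

leibniz-expandˡ : ∀ g k a l b →
  Leibniz (g ∘ (k ∷_)) a (l ∷ b) → Leibniz (g ∘ (l ∷_)) (k ∷ a) b → Leibniz (g ∘ ((k ⊞ l) ∷_)) a b →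
  ∑ (harmZ (k ∷ a) (l ∷ b)) (λ x → eval (D x) g) ≡ LeibnizTerms.total g k a l b
leibniz-expandˡ g k a l b h₁ h₂ h₃ =
  trans (harm-cons k a l b (λ x → eval (D x) g))
    (cong₂ _+_ (trans (split k (harmZ a (l ∷ b)))
                  (cong (wₖ * α₁ +_) (trans h₁ (cong (β₁ +_) (D-cons l b (harm (g ∘ (k ∷_)) a))))))
      (cong₂ _+_ (trans (split l (harmZ (k ∷ a) b))
                   (cong (wₗ * α₂ +_) (trans h₂ (cong (_+ γ₃) (D-cons k a (λ t → harm (g ∘ (l ∷_)) t b))))))
        (trans (split (k ⊞ l) (harmZ a b)) (cong₂ _+_ (cong (_* α₃) (weight-⊞ k l)) h₃))))
  where
  open LeibnizTerms g k a l b
  split : ∀ j L → ∑ L (λ x → eval (D (j ∷ x)) g) ≡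
          weight j * ∑ L (λ x → g (suc j ∷ x)) + ∑ L (λ x → eval (D x) (g ∘ (j ∷_)))
  split j L =
    trans (∑-cong L (λ x → D-cons j x g))
      (trans (∑-+ L (λ x → weight j * g (suc j ∷ x)) (λ x → eval (D x) (g ∘ (j ∷_))))
        (cong (_+ ∑ L (λ x → eval (D x) (g ∘ (j ∷_)))) (∑-* L (weight j) (λ x → g (suc j ∷ x)))))

leibniz-expandʳ : ∀ g k a l b →
  eval (D (k ∷ a)) (λ t → harm g t (l ∷ b)) + eval (D (l ∷ b)) (harm g (k ∷ a)) ≡ LeibnizTerms.total g k a l b
leibniz-expandʳ g k a l b =
  trans (cong₂ _+_
          (trans (D-cons k a (λ t → harm g t (l ∷ b)))
            (cong₂ _+_ (cong (wₖ *_) (harm-cons (suc k) a l b g))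
              (trans (eval-cong (D a) (λ t → harm-cons k t l b g)) (eval-+₃ (D a) _ _ _))))
          (trans (D-cons l b (harm g (k ∷ a)))
            (cong₂ _+_ (cong (wₗ *_) (trans (harm-cons k a (suc l) b g)
                         (cong (λ j → β₂ + (α₂ + harm (g ∘ (j ∷_)) a b)) (cong suc (ℕ.+-suc k l)))))
              (trans (eval-cong (D b) (λ t → harm-cons k a l t g)) (eval-+₃ (D b) _ _ _)))))
    (regroup wₖ wₗ α₁ α₂ α₃ β₁ β₂ β₃ γ₁ γ₂ γ₃ δ₁ δ₂)
  where
  open LeibnizTerms g k a l b
  regroup : ∀ wₖ wₗ α₁ α₂ α₃ β₁ β₂ β₃ γ₁ γ₂ γ₃ δ₁ δ₂ →
    (wₖ * (α₁ + (γ₁ + α₃)) + (β₁ + (γ₂ + δ₁))) + (wₗ * (β₂ + (α₂ + α₃)) + (β₃ + (γ₃ + δ₂))) ≡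
    (wₖ * α₁ + (β₁ + (wₗ * β₂ + β₃))) + ((wₗ * α₂ + ((wₖ * γ₁ + γ₂) + γ₃)) + ((wₖ + wₗ) * α₃ + (δ₁ + δ₂)))
  regroup = solve-∀ ℚ-ring

D-leibniz : ∀ g u v → Leibniz g u v
D-leibniz g [] v =
  trans (∑-[ v ] (λ x → eval (D x) g))
    (trans (eval-cong (D v) (λ t → sym (harm-identityˡ g t))) (sym (+-identityˡ _)))
D-leibniz g (k ∷ a) [] =
  trans (∑-[ k ∷ a ] (λ x → eval (D x) g))
    (trans (eval-cong (D (k ∷ a)) (λ t → sym (harm-identityʳ g t))) (sym (+-identityʳ _)))
D-leibniz g (k ∷ a) (l ∷ b) =
  trans (leibniz-expandˡ g k a l b (D-leibniz _ a (l ∷ b)) (D-leibniz _ (k ∷ a) b) (D-leibniz _ a b))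
    (sym (leibniz-expandʳ g k a l b))

sign : ZWord → ℚ
sign [] = 1ℚ
sign (_ ∷ w) = - sign w

coarseningsFrom : ℕ → ZWord → List ZWord
coarseningsFrom k [] = (k ∷ []) ∷ []
coarseningsFrom k (m ∷ r) = map (k ∷_) (coarseningsFrom m r) ++ coarseningsFrom (k ⊞ m) r

coarsenings : ZWord → List ZWord
coarsenings [] = [] ∷ []
coarsenings (k ∷ r) = coarseningsFrom k r

signedCoarsenings : ZWord → List (ℚ × ZWord)
signedCoarsenings w = map (sign w ,_) (coarsenings w)

-- Hoffman's formula for the antipode of the quasi-shuffle algebra (ℌ¹, ∗).
antipode : ZWord → List (ℚ × ZWord)
antipode p = signedCoarsenings (reverse p)

eval-antipode-[] : ∀ g → eval (antipode []) g ≡ g []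
eval-antipode-[] g = trans (+-identityʳ _) (*-identityˡ _)

mergeHead : ℕ → (ZWord → ℚ) → ZWord → ℚ
mergeHead a g [] = 0ℚ
mergeHead a g (b ∷ r) = g ((a ⊞ b) ∷ r)

∑-coarseningsFrom-mergeHead : ∀ a m r g → ∑ (coarseningsFrom m r) (mergeHead a g) ≡ ∑ (coarseningsFrom (a ⊞ m) r) g
∑-coarseningsFrom-mergeHead a m [] g = refl
∑-coarseningsFrom-mergeHead a m (n ∷ r) g = begin
  ∑ (map (m ∷_) (coarseningsFrom n r) ++ coarseningsFrom (m ⊞ n) r) (mergeHead a g)
    ≡⟨ ∑-++ (map (m ∷_) (coarseningsFrom n r)) _ (mergeHead a g) ⟩
  ∑ (map (m ∷_) (coarseningsFrom n r)) (mergeHead a g) + ∑ (coarseningsFrom (m ⊞ n) r) (mergeHead a g)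
    ≡⟨ cong₂ _+_ (∑-map (m ∷_) (coarseningsFrom n r) (mergeHead a g))
                 (trans (∑-coarseningsFrom-mergeHead a (m ⊞ n) r g)
                        (cong (λ j → ∑ (coarseningsFrom j r) g) (sym (⊞-assoc a m n)))) ⟩
  ∑ (coarseningsFrom n r) (g ∘ ((a ⊞ m) ∷_)) + ∑ (coarseningsFrom ((a ⊞ m) ⊞ n) r) g
    ≡⟨ cong (_+ ∑ (coarseningsFrom ((a ⊞ m) ⊞ n) r) g) (∑-map ((a ⊞ m) ∷_) (coarseningsFrom n r) g) ⟨
  ∑ (map ((a ⊞ m) ∷_) (coarseningsFrom n r)) g + ∑ (coarseningsFrom ((a ⊞ m) ⊞ n) r) g
    ≡⟨ ∑-++ (map ((a ⊞ m) ∷_) (coarseningsFrom n r)) _ g ⟨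
  ∑ (coarseningsFrom (a ⊞ m) (n ∷ r)) g ∎

∑-coarsenings-cons : ∀ a t g → ∑ (coarsenings (a ∷ t)) g ≡ ∑ (coarsenings t) (g ∘ (a ∷_)) + ∑ (coarsenings t) (mergeHead a g)
∑-coarsenings-cons a [] g = sym (+-identityʳ (g (a ∷ []) + 0ℚ))
∑-coarsenings-cons a (m ∷ r) g =
  trans (∑-++ (map (a ∷_) (coarseningsFrom m r)) _ g)
    (cong₂ _+_ (∑-map (a ∷_) (coarseningsFrom m r) g) (sym (∑-coarseningsFrom-mergeHead a m r g)))

eval-signedCoarsenings-cons : ∀ a t g → eval (signedCoarsenings (a ∷ t)) g ≡
  - (eval (signedCoarsenings t) (g ∘ (a ∷_)) + eval (signedCoarsenings t) (mergeHead a g))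
eval-signedCoarsenings-cons a t g = begin
  eval (signedCoarsenings (a ∷ t)) g
    ≡⟨ eval-withCoeff (- sign t) (coarsenings (a ∷ t)) g ⟩
  - sign t * ∑ (coarsenings (a ∷ t)) g
    ≡⟨ cong (- sign t *_) (∑-coarsenings-cons a t g) ⟩
  - sign t * (∑ (coarsenings t) (g ∘ (a ∷_)) + ∑ (coarsenings t) (mergeHead a g))
    ≡⟨ neg-distrib-* (sign t) _ _ ⟩
  - (sign t * ∑ (coarsenings t) (g ∘ (a ∷_)) + sign t * ∑ (coarsenings t) (mergeHead a g))
    ≡⟨ cong -_ (cong₂ _+_ (eval-withCoeff (sign t) (coarsenings t) (g ∘ (a ∷_)))
                          (eval-withCoeff (sign t) (coarsenings t) (mergeHead a g))) ⟨
  - (eval (signedCoarsenings t) (g ∘ (a ∷_)) + eval (signedCoarsenings t) (mergeHead a g)) ∎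
  where neg-distrib-* : ∀ s x y → (- s) * (x + y) ≡ - (s * x + s * y)
        neg-distrib-* = solve-∀ ℚ-ring

antipode-snoc : ∀ p a g → eval (antipode (p ++ a ∷ [])) g ≡ - (eval (antipode p) (g ∘ (a ∷_)) + eval (antipode p) (mergeHead a g))
antipode-snoc p a g =
  trans (cong (λ z → eval (signedCoarsenings z) g) (List.reverse-++ p (a ∷ []))) (eval-signedCoarsenings-cons a (reverse p) g)

harmFromLeft : (ZWord → ℚ) → ZWord → ZWord → ℚ
harmFromLeft h [] q = 0ℚ
harmFromLeft h (b ∷ r) q = harm (h ∘ (b ∷_)) r q

harm-split-[] : ∀ h y → harm h y [] ≡ harmFromLeft h y [] + counit y (h [])
harm-split-[] h [] = trans (harm-identityʳ h []) (sym (+-identityˡ _))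
harm-split-[] h (b ∷ r) = trans (harm-identityʳ h (b ∷ r)) (sym (trans (+-identityʳ _) (harm-identityʳ (h ∘ (b ∷_)) r)))

harm-split-∷ : ∀ h a q y → harm h y (a ∷ q) ≡
  harmFromLeft h y (a ∷ q) + (harm (h ∘ (a ∷_)) y q + mergeHead a (λ y′ → harmFromLeft h y′ q) y)
harm-split-∷ h a q [] =
  trans (harm-identityˡ h (a ∷ q)) (sym (trans (+-identityˡ _) (trans (+-identityʳ _) (harm-identityˡ (h ∘ (a ∷_)) q))))
harm-split-∷ h a q (b ∷ r) =
  trans (harm-cons b r a q h)
    (cong (λ j → harm (h ∘ (b ∷_)) r (a ∷ q) + (harm (h ∘ (a ∷_)) (b ∷ r) q + harm (h ∘ (j ∷_)) r q)) (⊞-comm b a))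

mergeHead-counit : ∀ a c y → mergeHead a (λ y′ → counit y′ c) y ≡ 0ℚ
mergeHead-counit a c [] = refl
mergeHead-counit a c (b ∷ r) = refl

-- Summing over q = q₁ q₂ telescopes: by antipode-snoc, the terms with nonempty q₁ cancel
-- every part of S(p) ∗ q except the one whose first letter comes from S(p).
antipode⋆id-prefix : ∀ h q p → Δ q (λ q₁ q₂ → eval (antipode (p ++ q₁)) (λ y → harm h y q₂)) ≡
  eval (antipode p) (λ y → harmFromLeft h y q) + counit q (eval (antipode p) (λ y → counit y (h [])))
antipode⋆id-prefix h [] p =
  trans (Δ-nil (λ q₁ q₂ → eval (antipode (p ++ q₁)) (λ y → harm h y q₂)))
    (trans (cong (λ z → eval (antipode z) (λ y → harm h y [])) (List.++-identityʳ p))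
      (trans (eval-cong (antipode p) (harm-split-[] h))
        (eval-+ (antipode p) (λ y → harmFromLeft h y []) (λ y → counit y (h [])))))
antipode⋆id-prefix h (a ∷ q) p = begin
  Δ (a ∷ q) (λ q₁ q₂ → eval (antipode (p ++ q₁)) (λ y → harm h y q₂))
    ≡⟨ Δ-cons a q (λ q₁ q₂ → eval (antipode (p ++ q₁)) (λ y → harm h y q₂)) ⟩
  eval (antipode (p ++ [])) (λ y → harm h y (a ∷ q)) +
    Δ q (λ q₁ q₂ → eval (antipode (p ++ a ∷ q₁)) (λ y → harm h y q₂))
    ≡⟨ cong₂ _+_ first (trans (Δ-cong q (λ q₁ q₂ → cong (λ z → eval (antipode z) (λ y → harm h y q₂))
                                                          (sym (List.++-assoc p (a ∷ []) q₁))))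
                              (antipode⋆id-prefix h q (p ++ a ∷ []))) ⟩
  (Sₚ + (Sₐ + Sₘ)) + (eval (antipode (p ++ a ∷ [])) (λ y → harmFromLeft h y q) + counit q Zₐ)
    ≡⟨ cong (λ t → (Sₚ + (Sₐ + Sₘ)) + (t + counit q Zₐ)) (antipode-snoc p a (λ y → harmFromLeft h y q)) ⟩
  (Sₚ + (Sₐ + Sₘ)) + (- (Sₐ + Sₘ) + counit q Zₐ)
    ≡⟨ cong (λ t → (Sₚ + (Sₐ + Sₘ)) + (- (Sₐ + Sₘ) + counit q t)) Zₐ≡0 ⟩
  (Sₚ + (Sₐ + Sₘ)) + (- (Sₐ + Sₘ) + counit q 0ℚ)
    ≡⟨ cong (λ t → (Sₚ + (Sₐ + Sₘ)) + (- (Sₐ + Sₘ) + t)) (counit-zero q) ⟩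
  (Sₚ + (Sₐ + Sₘ)) + (- (Sₐ + Sₘ) + 0ℚ)
    ≡⟨ cancel Sₚ (Sₐ + Sₘ) ⟩
  Sₚ + 0ℚ ∎
  where
  Sₚ Sₐ Sₘ Zₐ : ℚ
  Sₚ = eval (antipode p) (λ y → harmFromLeft h y (a ∷ q))
  Sₐ = eval (antipode p) (λ y → harm (h ∘ (a ∷_)) y q)
  Sₘ = eval (antipode p) (mergeHead a (λ y′ → harmFromLeft h y′ q))
  Zₐ = eval (antipode (p ++ a ∷ [])) (λ y → counit y (h []))
  first : eval (antipode (p ++ [])) (λ y → harm h y (a ∷ q)) ≡ Sₚ + (Sₐ + Sₘ)
  first = trans (cong (λ z → eval (antipode z) (λ y → harm h y (a ∷ q))) (List.++-identityʳ p))
            (trans (eval-cong (antipode p) (harm-split-∷ h a q)) (eval-+₃ (antipode p) _ _ _))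
  Zₐ≡0 : Zₐ ≡ 0ℚ
  Zₐ≡0 = trans (antipode-snoc p a (λ y → counit y (h [])))
          (cong -_ (trans (cong₂ _+_ (eval-zero (antipode p)) (eval-vanish (antipode p) (mergeHead-counit a (h []))))
                          (+-identityˡ 0ℚ)))
  cancel : ∀ u x → (u + x) + (- x + 0ℚ) ≡ u + 0ℚ
  cancel = solve-∀ ℚ-ring

antipode⋆id : ∀ h w → Δ w (λ p q → eval (antipode p) (λ y → harm h y q)) ≡ counit w (h [])
antipode⋆id h w =
  trans (antipode⋆id-prefix h w [])
    (trans (cong₂ _+_ (eval-antipode-[] (λ y → harmFromLeft h y w)) (cong (counit w) (eval-antipode-[] (λ y → counit y (h [])))))
      (+-identityˡ _))

id⋆antipode-cons : ∀ k w →
  (∀ s → length s ≤ length w → ∀ h → Δ s (λ p q → eval (antipode q) (harm h p)) ≡ counit s (h [])) →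
  ∀ h → Δ (k ∷ w) (λ p q → eval (antipode q) (harm h p)) ≡ 0ℚ
id⋆antipode-cons k w IH h =
  identityˡ-unique _ _ (trans (sym viaRight) (trans (sym (Δ-coassoc (k ∷ w) K)) viaLeft))
  where
  -- K a b c = ⟨S(a) ∗ b ∗ S(c), h⟩, summed over w = a b c in two ways.
  K : ZWord → ZWord → ZWord → ℚ
  K a b c = eval (antipode a) (λ x → eval (antipode c) (harm₃ˡ h x b))
  viaLeft : Δ (k ∷ w) (λ s c → Δ s (λ a b → K a b c)) ≡ eval (antipode (k ∷ w)) h
  viaLeft =
    trans (Δ-cong (k ∷ w) inner)
      (trans (Δ-counitˡ (k ∷ w) (λ c → eval (antipode c) (harm h [])))
        (eval-cong (antipode (k ∷ w)) (harm-identityˡ h)))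
    where
    inner : ∀ s c → Δ s (λ a b → K a b c) ≡ counit s (eval (antipode c) (harm h []))
    inner s c =
      trans (Δ-cong s (λ a b → eval-swap (antipode a) (antipode c) (λ x → harm₃ˡ h x b)))
        (trans (Δ-eval s (antipode c) (λ a b z → eval (antipode a) (λ x → harm₃ˡ h x b z)))
          (trans (eval-cong (antipode c) (λ z → antipode⋆id (λ y → harm h y z) s))
            (eval-counit (antipode c) s (harm h []))))
  viaRight : Δ (k ∷ w) (λ a s → Δ s (λ b c → K a b c)) ≡
             Δ (k ∷ w) (λ p q → eval (antipode q) (harm h p)) + eval (antipode (k ∷ w)) h
  viaRight =
    trans (Δ-cong (k ∷ w) inner)
      (trans (Δ-cons k w (λ a s → eval (antipode a) (λ x → Δ s (λ b c → eval (antipode c) (harm (harm h x) b)))))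
        (cong₂ _+_ (trans (eval-antipode-[] (λ x → Δ (k ∷ w) (λ b c → eval (antipode c) (harm (harm h x) b)))) (Δ-cong (k ∷ w) (λ b c → eval-cong (antipode c) (λ y → harm-cong b y (harm-identityˡ h)))))
          (trans (Δ-congʳ w (λ a s ls → eval-cong (antipode (k ∷ a)) (λ x → IH s ls (harm h x))))
            (trans (Δ-cong w (λ a s → eval-counit (antipode (k ∷ a)) s (λ x → harm h x [])))
              (trans (Δ-counitʳ w (λ a → eval (antipode (k ∷ a)) (λ x → harm h x [])))
                (eval-cong (antipode (k ∷ w)) (harm-identityʳ h)))))))
    where
    inner : ∀ a s → Δ s (λ b c → K a b c) ≡ eval (antipode a) (λ x → Δ s (λ b c → eval (antipode c) (harm (harm h x) b)))
    inner a s =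
      trans (Δ-eval s (antipode a) (λ b c x → eval (antipode c) (harm₃ˡ h x b)))
        (eval-cong (antipode a) (λ x → Δ-cong s (λ b c → eval-cong (antipode c) (harm-assoc h x b))))

id⋆antipode : ∀ r h → Δ r (λ p q → eval (antipode q) (harm h p)) ≡ counit r (h [])
id⋆antipode r = bounded (length r) r ℕ.≤-refl
  where
  bounded : ∀ n r → length r ≤ n → ∀ h → Δ r (λ p q → eval (antipode q) (harm h p)) ≡ counit r (h [])
  bounded n [] _ h =
    trans (Δ-nil (λ p q → eval (antipode q) (harm h p))) (trans (eval-antipode-[] (harm h [])) (harm-identityˡ h []))
  bounded (suc n) (k ∷ w) (s≤s le) = id⋆antipode-cons k w (λ s ls → bounded n s (ℕ.≤-trans ls le))

antipode∘D : ZWord → (ZWord → ℚ) → ℚ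
antipode∘D q k = eval (D q) (λ q′ → eval (antipode q′) k)

antipode∘D-cong : ∀ q {k k′ : ZWord → ℚ} → (∀ x → k x ≡ k′ x) → antipode∘D q k ≡ antipode∘D q k′
antipode∘D-cong q e = eval-cong (D q) (λ q′ → eval-cong (antipode q′) e)

-- Ψ p h = ⟨(id ⋆ S∘D)(p), h⟩; ψZ-eval identifies it with ψ.
Ψ : ZWord → (ZWord → ℚ) → ℚ
Ψ p h = Δ p (λ a b → antipode∘D b (harm h a))

Ψ-cong : ∀ p {h h′ : ZWord → ℚ} → (∀ x → h x ≡ h′ x) → Ψ p h ≡ Ψ p h′
Ψ-cong p e = Δ-cong p (λ a b → antipode∘D-cong b (λ y → harm-cong a y e))

-- D is a coderivation, so (S ∘ D) ⋆ id + S ⋆ D = (S ⋆ id) ∘ D = ε ∘ D = 0.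
antipode∘D⋆id : ∀ r h → Δ r (λ b q → antipode∘D b (λ y → harm h y q)) ≡
                        - Δ r (λ b q → eval (antipode b) (λ y → eval (D q) (harm h y)))
antipode∘D⋆id r h = inverseˡ-unique _ _ (begin
  Δ r (λ b q → antipode∘D b (λ y → harm h y q)) + Δ r (λ b q → eval (antipode b) (λ y → eval (D q) (harm h y)))
    ≡⟨ Δ-+ r (λ b q → antipode∘D b (λ y → harm h y q)) _ ⟨
  Δ r (λ b q → antipode∘D b (λ y → harm h y q) + eval (antipode b) (λ y → eval (D q) (harm h y)))
    ≡⟨ Δ-cong r (λ b q → cong (antipode∘D b (λ y → harm h y q) +_) (eval-swap (antipode b) (D q) (harm h))) ⟩
  Δ r (λ b q → eval (D b) (λ b′ → F b′ q) + eval (D q) (F b))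
    ≡⟨ Δ-D r F ⟨
  eval (D r) (λ r′ → Δ r′ F)
    ≡⟨ eval-cong (D r) (antipode⋆id h) ⟩
  eval (D r) (λ r′ → counit r′ (h []))
    ≡⟨ eval-D-counit r (h []) ⟩
  0ℚ ∎)
  where
  F : ZWord → ZWord → ℚ
  F b q = eval (antipode b) (λ y → harm h y q)

-- ψ ⋆ id = id ⋆ (S ∘ D) ⋆ id = −(id ⋆ S ⋆ D) = −D.
Ψ⋆id : ∀ w g → Δ w (λ p q → Ψ p (λ y → harm g y q)) ≡ - eval (D w) g
Ψ⋆id w g = begin
  Δ w (λ s q → Δ s (λ a b → K a b q))
    ≡⟨ Δ-coassoc w K ⟩
  Δ w (λ a s → Δ s (λ b q → K a b q))
    ≡⟨ Δ-cong w (λ a s → trans (Δ-cong s (λ b q → antipode∘D-cong b (λ y → harm-assoc g a y q)))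
                               (antipode∘D⋆id s (harm g a))) ⟩
  Δ w (λ a s → - Δ s (λ b q → K′ a b q))
    ≡⟨ Δ-neg w (λ a s → Δ s (λ b q → K′ a b q)) ⟩
  - Δ w (λ a s → Δ s (λ b q → K′ a b q))
    ≡⟨ cong -_ (Δ-coassoc w K′) ⟨
  - Δ w (λ s q → Δ s (λ a b → K′ a b q))
    ≡⟨ cong -_ (Δ-cong w inner) ⟩
  - Δ w (λ s q → counit s (eval (D q) (harm g [])))
    ≡⟨ cong -_ (trans (Δ-counitˡ w (λ q → eval (D q) (harm g []))) (eval-cong (D w) (harm-identityˡ g))) ⟩
  - eval (D w) g ∎
  where
  K K′ : ZWord → ZWord → ZWord → ℚ
  K a b q = antipode∘D b (harm (λ y → harm g y q) a)
  K′ a b q = eval (antipode b) (λ y → eval (D q) (harm (harm g a) y))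
  inner : ∀ s q → Δ s (λ a b → K′ a b q) ≡ counit s (eval (D q) (harm g []))
  inner s q =
    trans (Δ-cong s (λ a b → eval-swap (antipode b) (D q) (harm (harm g a))))
      (trans (Δ-eval s (D q) (λ a b q′ → eval (antipode b) (λ y → harm (harm g a) y q′)))
        (trans (eval-cong (D q) (λ q′ → trans (Δ-cong s (λ a b → eval-cong (antipode b) (λ y → sym (harm-assoc g a y q′))))
                                              (id⋆antipode s (λ t → harm g t q′))))
          (eval-counit (D q) s (harm g []))))

Ψ-∑ : ∀ p (L : List B) (f : B → ZWord → ℚ) → Ψ p (λ y → ∑ L (λ l → f l y)) ≡ ∑ L (λ l → Ψ p (f l))
Ψ-∑ p L f =
  trans (Δ-cong p (λ a b → trans (antipode∘D-cong b (λ y → ∑-swap (harmZ a y) L (λ y′ l → f l y′)))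
                                 (trans (eval-cong (D b) (λ b′ → eval-∑ (antipode b′) L (λ y l → harm (f l) a y)))
                                        (eval-∑ (D b) L (λ b′ l → eval (antipode b′) (harm (f l) a))))))
    (∑-swap (splits p) L (λ { (a , b) l → antipode∘D b (harm (f l) a) }))

Ψ∘harm : ZWord → ZWord → (ZWord → ℚ) → ℚ
Ψ∘harm u v g = ∑ (harmZ u v) (λ x → Ψ x g)

Ψ∘harm-cong : ∀ u v {h h′ : ZWord → ℚ} → (∀ x → h x ≡ h′ x) → Ψ∘harm u v h ≡ Ψ∘harm u v h′
Ψ∘harm-cong u v e = ∑-cong (harmZ u v) (λ x → Ψ-cong x e)

-- (ψ ⋆ id)(u ∗ v) = −D(u ∗ v) = −(Du ∗ v + u ∗ Dv)
Ψ⋆id-harm : ∀ g u v → ∑ (harmZ u v) (λ x → Δ x (λ p q → Ψ p (λ y → harm g y q))) ≡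
                      - (eval (D u) (λ t → harm g t v) + eval (D v) (harm g u))
Ψ⋆id-harm g u v =
  trans (∑-cong (harmZ u v) (λ x → Ψ⋆id x g))
    (trans (∑-neg (harmZ u v) (λ x → eval (D x) g)) (cong -_ (D-leibniz g u v)))

-- Δ(u ∗ v) = Δu ∗ Δv turns (ψ ⋆ id)(u ∗ v) into a sum of ψ(u₁ ∗ v₁) ∗ (u₂ ∗ v₂).
Ψ⋆id-harm-split : ∀ g u v → ∑ (harmZ u v) (λ x → Δ x (λ p q → Ψ p (λ y → harm g y q))) ≡
                  Δ u (λ u₁ u₂ → Δ v (λ v₁ v₂ → Ψ∘harm u₁ v₁ (λ y → harm (harm g y) u₂ v₂)))
Ψ⋆id-harm-split g u v =
  trans (Δ-harm (λ p q → Ψ p (λ y → harm g y q)) u v)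
    (Δ-cong u (λ u₁ u₂ → Δ-cong v (λ v₁ v₂ → ∑-cong (harmZ u₁ v₁)
      (λ p → sym (Ψ-∑ p (harmZ u₂ v₂) (λ q y → harm g y q))))))

Ψ∘harm-cons : ∀ k a l b →
  (∀ a′ b′ → length a′ +ℕ length b′ < length a +ℕ length b → ∀ g → Ψ∘harm (k ∷ a′) (l ∷ b′) g ≡ 0ℚ) →
  ∀ g → Ψ∘harm (k ∷ a) (l ∷ b) g ≡ 0ℚ
Ψ∘harm-cons k a l b IH g =
  cancel Dᵤ Dᵥ (Ψ∘harm u v g) (trans (sym (Ψ⋆id-harm g u v)) (trans (Ψ⋆id-harm-split g u v) expansion))
  where
  u v : ZWord
  u = k ∷ a
  v = l ∷ b
  H : ZWord → ZWord → ZWord → ℚ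
  H u₂ v₂ y = harm (harm g y) u₂ v₂
  Dᵤ Dᵥ : ℚ
  Dᵤ = eval (D u) (λ t → harm g t v)
  Dᵥ = eval (D v) (harm g u)

  firstEmpty : Δ v (λ v₁ v₂ → Ψ∘harm [] v₁ (H u v₂)) ≡ - Dᵥ
  firstEmpty =
    trans (Δ-cong v (λ v₁ v₂ → trans (∑-[ v₁ ] (λ x → Ψ x (H u v₂))) (Ψ-cong v₁ (λ y → reorder y v₂))))
      (Ψ⋆id v (harm g u))
    where
    reorder : ∀ y v₂ → H u v₂ y ≡ harm (harm g u) y v₂
    reorder y v₂ = trans (sym (harm-assoc g y u v₂)) (trans (harm-comm (λ x → harm g x v₂) y u) (harm-assoc g u y v₂))

  secondEmpty : Δ a (λ a′ u₂ → Ψ∘harm (k ∷ a′) [] (H u₂ v)) ≡ - Dᵤ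
  secondEmpty = begin
    Δ a (λ a′ u₂ → Ψ∘harm (k ∷ a′) [] (H u₂ v))
      ≡⟨ Δ-cong a (λ a′ u₂ → trans (∑-[ k ∷ a′ ] (λ x → Ψ x (H u₂ v)))
                                   (Ψ-cong (k ∷ a′) (λ y → sym (harm-assoc g y u₂ v)))) ⟩
    Δ a (λ a′ u₂ → Ψ (k ∷ a′) (λ y → harm gᵥ y u₂))
      ≡⟨ +-identityˡ _ ⟨
    0ℚ + Δ a (λ a′ u₂ → Ψ (k ∷ a′) (λ y → harm gᵥ y u₂))
      ≡⟨ cong (_+ Δ a (λ a′ u₂ → Ψ (k ∷ a′) (λ y → harm gᵥ y u₂))) (Δ-nil (λ a′ b′ → antipode∘D b′ (harm (λ y → harm gᵥ y u) a′))) ⟨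
    Ψ [] (λ y → harm gᵥ y u) + Δ a (λ a′ u₂ → Ψ (k ∷ a′) (λ y → harm gᵥ y u₂))
      ≡⟨ Δ-cons k a (λ p q → Ψ p (λ y → harm gᵥ y q)) ⟨
    Δ u (λ p q → Ψ p (λ y → harm gᵥ y q))
      ≡⟨ Ψ⋆id u gᵥ ⟩
    - Dᵤ ∎
    where
    gᵥ : ZWord → ℚ
    gᵥ t = harm g t v

  -- Only u₂ = v₂ = [] survives; all other terms vanish by induction.
  bothNonempty : Δ a (λ a′ u₂ → Δ b (λ b′ v₂ → Ψ∘harm (k ∷ a′) (l ∷ b′) (H u₂ v₂))) ≡ Ψ∘harm u v g
  bothNonempty = begin
    Δ a (λ a′ u₂ → Δ b (λ b′ v₂ → Ψ∘harm (k ∷ a′) (l ∷ b′) (H u₂ v₂)))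
      ≡⟨ Δ-congˡ a inner ⟩
    Δ a (λ a′ u₂ → Ψ∘harm (k ∷ a′) v (H u₂ []))
      ≡⟨ Δ-last a (λ a′ u₂ → Ψ∘harm (k ∷ a′) v (H u₂ [])) ⟩
    Δ⁺ a (λ a′ u₂ → Ψ∘harm (k ∷ a′) v (H u₂ [])) + Ψ∘harm u v (H [] [])
      ≡⟨ cong (_+ Ψ∘harm u v (H [] [])) (Δ⁺-vanish a (λ a′ u₂ la → IH a′ b (ℕ.+-mono-<-≤ la ℕ.≤-refl) (H u₂ []))) ⟩
    0ℚ + Ψ∘harm u v (H [] [])
      ≡⟨ +-identityˡ _ ⟩
    Ψ∘harm u v (H [] [])
      ≡⟨ Ψ∘harm-cong u v (λ y → trans (∑-[ [] ] (harm g y)) (harm-identityʳ g y)) ⟩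
    Ψ∘harm u v g ∎
    where
    inner : ∀ a′ u₂ → length a′ ≤ length a →
            Δ b (λ b′ v₂ → Ψ∘harm (k ∷ a′) (l ∷ b′) (H u₂ v₂)) ≡ Ψ∘harm (k ∷ a′) v (H u₂ [])
    inner a′ u₂ la =
      trans (Δ-last b (λ b′ v₂ → Ψ∘harm (k ∷ a′) (l ∷ b′) (H u₂ v₂)))
        (trans (cong (_+ Ψ∘harm (k ∷ a′) v (H u₂ []))
                     (Δ⁺-vanish b (λ b′ v₂ lb → IH a′ b′ (ℕ.+-mono-≤-< la lb) (H u₂ v₂))))
          (+-identityˡ _))

  expansion : Δ u (λ u₁ u₂ → Δ v (λ v₁ v₂ → Ψ∘harm u₁ v₁ (H u₂ v₂))) ≡ - Dᵥ + (- Dᵤ + Ψ∘harm u v g)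
  expansion =
    trans (Δ-cons k a (λ u₁ u₂ → Δ v (λ v₁ v₂ → Ψ∘harm u₁ v₁ (H u₂ v₂))))
      (cong₂ _+_ firstEmpty
        (trans (Δ-cong a (λ a′ u₂ → Δ-cons l b (λ v₁ v₂ → Ψ∘harm (k ∷ a′) v₁ (H u₂ v₂))))
          (trans (Δ-+ a (λ a′ u₂ → Ψ∘harm (k ∷ a′) [] (H u₂ v)) _) (cong₂ _+_ secondEmpty bothNonempty))))

  cancel : ∀ x y t → - (x + y) ≡ - y + (- x + t) → t ≡ 0ℚ
  cancel x y t e = trans (regroup x y t) (trans (cong (_+ (x + y)) (sym e)) (+-inverseˡ (x + y)))
    where regroup : ∀ x y t → t ≡ (- y + (- x + t)) + (x + y)
          regroup = solve-∀ ℚ-ring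

Ψ∘harm-vanishes : ∀ k a l b g → Ψ∘harm (k ∷ a) (l ∷ b) g ≡ 0ℚ
Ψ∘harm-vanishes k a l b = bounded (suc (length a +ℕ length b)) a b ℕ.≤-refl
  where
  bounded : ∀ n a b → length a +ℕ length b < n → ∀ g → Ψ∘harm (k ∷ a) (l ∷ b) g ≡ 0ℚ
  bounded (suc n) a b (s≤s le) =
    Ψ∘harm-cons k a l b (λ a′ b′ lt → bounded n a′ b′ (ℕ.≤-trans lt le))

eval-scale : ∀ a (p : Poly) g → eval (scale a p) g ≡ a * eval p g
eval-scale a [] g = sym (*-zeroʳ a)
eval-scale a ((c , x) ∷ p) g =
  trans (cong₂ _+_ (*-assoc a c (g x)) (eval-scale a p g)) (sym (*-distribˡ-+ a (c * g x) (eval p g)))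

eval-lin : ∀ (f : Word → Poly) (p : Poly) g → eval (lin f p) g ≡ eval p (λ w → eval (f w) g)
eval-lin f [] g = refl
eval-lin f ((c , x) ∷ p) g =
  trans (eval-++ (scale c (f x)) (lin f p) g) (cong₂ _+_ (eval-scale c (f x) g) (eval-lin f p g))

eval-bilin : ∀ (f : Word → Word → Poly) (p q : Poly) g →
             eval (bilin f p q) g ≡ eval p (λ u → eval q (λ v → eval (f u v) g))
eval-bilin f p q g = trans (eval-lin (λ u → lin (f u) q) p g) (eval-cong p (λ u → eval-lin (f u) q g))

eval-sumP : ∀ (L : List Poly) g → eval (sumP L) g ≡ ∑ L (λ P → eval P g)
eval-sumP [] g = refl
eval-sumP (P ∷ L) g = trans (eval-++ P (sumP L) g) (cong (eval P g +_) (eval-sumP L g))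

eval-pre : ∀ l (p : Poly) g → eval (pre l p) g ≡ eval p (g ∘ (l ∷_))
eval-pre l [] g = refl
eval-pre l ((c , x) ∷ p) g = cong (c * g (l ∷ x) +_) (eval-pre l p g)

eval-word : ∀ w g → eval (word w) g ≡ g w
eval-word w g = trans (+-identityʳ _) (*-identityˡ (g w))

eval-ofWords : ∀ L g → eval (ofWords L) g ≡ ∑ L g
eval-ofWords L g = trans (eval-withCoeff 1ℚ L g) (*-identityˡ _)

eval-d : ∀ (p : Poly) g → eval (d p) g ≡ eval p (λ w → signW w * g w)
eval-d [] g = refl
eval-d ((c , x) ∷ p) g = cong₂ _+_ (*-assoc c (signW x) (g x)) (eval-d p g)

indicator : Word → Word → ℚ
indicator w u with u ≟W w
... | yes _ = 1ℚ
... | no _ = 0ℚ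

coeff-eval : ∀ (p : Poly) w → coeff p w ≡ eval p (indicator w)
coeff-eval [] w = refl
coeff-eval ((c , u) ∷ p) w with u ≟W w
... | yes _ = cong₂ _+_ (sym (*-identityʳ c)) (coeff-eval p w)
... | no _ = trans (coeff-eval p w) (sym (trans (cong (_+ eval p (indicator w)) (*-zeroʳ c)) (+-identityˡ _)))

toZ′-replicate : ∀ k n w → toZ' n (replicate k X ++ w) ≡ toZ' (k +ℕ n) w
toZ′-replicate zero n w = refl
toZ′-replicate (suc k) n w = trans (toZ′-replicate k (suc n) w) (cong (λ j → toZ' j w) (ℕ.+-suc k n))

toZ′-fromZ : ∀ k ks → toZ' k (fromZ ks) ≡ k ∷ ks
toZ′-tail-fromZ : ∀ m ks → toZ' 0 (replicate m X ++ fromZ ks) ≡ m ∷ ks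

toZ′-fromZ k [] = refl
toZ′-fromZ k (m ∷ ks) = cong (k ∷_) (toZ′-tail-fromZ m ks)

toZ′-tail-fromZ m ks =
  trans (toZ′-replicate m 0 (fromZ ks)) (trans (cong (λ j → toZ' j (fromZ ks)) (ℕ.+-identityʳ m)) (toZ′-fromZ m ks))

toZ′-nonempty : ∀ n w → Σ[ k ∈ ℕ ] Σ[ r ∈ ZWord ] toZ' n w ≡ k ∷ r
toZ′-nonempty n [] = n , [] , refl
toZ′-nonempty n (X ∷ w) = toZ′-nonempty (suc n) w
toZ′-nonempty n (Y ∷ w) = n , toZ' 0 w , refl

ψW-fromZ : ∀ z → ψW (fromZ z) ≡ ψZ z
ψW-fromZ [] = refl
ψW-fromZ (k ∷ r) = cong ψZ (toZ′-tail-fromZ k r)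

toZ-fromZ : ∀ z → toZ (fromZ z) ≡ just z
toZ-fromZ [] = refl
toZ-fromZ (k ∷ r) = cong just (toZ′-tail-fromZ k r)

eval-harmW-fromZ : ∀ p y φ → eval (harmW (fromZ p) (fromZ y)) φ ≡ harm (φ ∘ fromZ) p y
eval-harmW-fromZ p y φ rewrite toZ-fromZ p | toZ-fromZ y =
  trans (eval-ofWords (map fromZ (harmZ p y)) φ) (∑-map fromZ (harmZ p y) φ)

-- Inserting x into the leading block y x^k of a z-word can be done in k + 1 places, all giving y x^(k+1).
∑-shuffle-x : ∀ ks k (h : Word → ℚ) → ∑ (shW (replicate k X ++ fromZ ks) (X ∷ [])) h ≡
  weight k * h (replicate (suc k) X ++ fromZ ks) + eval (D ks) (λ z → h (replicate k X ++ fromZ z))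
∑-shuffle-x [] zero h = regroup (h (X ∷ []))
  where regroup : ∀ H → H + 0ℚ ≡ 1ℚ * H + 0ℚ
        regroup = solve-∀ ℚ-ring
∑-shuffle-x (m ∷ r) zero h =
  trans (∑-++ (map (Y ∷_) (shW w (X ∷ []))) (map (X ∷_) ((Y ∷ w) ∷ [])) h)
    (trans (cong (_+ (h (X ∷ Y ∷ w) + 0ℚ)) (trans (∑-map (Y ∷_) (shW w (X ∷ [])) h) (∑-shuffle-x r m (h ∘ (Y ∷_)))))
      (trans (regroup (weight m * h (Y ∷ replicate (suc m) X ++ fromZ r)) (eval (D r) (λ z → h (Y ∷ replicate m X ++ fromZ z)))
                      (h (X ∷ Y ∷ w)))
        (cong (1ℚ * h (X ∷ Y ∷ w) +_) (sym (D-cons m r (h ∘ fromZ))))))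
  where
  w : Word
  w = replicate m X ++ fromZ r
  regroup : ∀ A R H → (A + R) + (H + 0ℚ) ≡ 1ℚ * H + (A + R)
  regroup = solve-∀ ℚ-ring
∑-shuffle-x ks (suc k) h =
  trans (∑-++ (map (X ∷_) (shW w (X ∷ []))) (map (X ∷_) ((X ∷ w) ∷ [])) h)
    (trans (cong (_+ (h (X ∷ X ∷ w) + 0ℚ)) (trans (∑-map (X ∷_) (shW w (X ∷ [])) h) (∑-shuffle-x ks k (h ∘ (X ∷_)))))
      (regroup (weight k) (h (X ∷ X ∷ w)) (eval (D ks) (λ z → h (X ∷ replicate k X ++ fromZ z)))))
  where
  w : Word
  w = replicate k X ++ fromZ ks
  regroup : ∀ c H R → (c * H + R) + (H + 0ℚ) ≡ (1ℚ + c) * H + R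
  regroup = solve-∀ ℚ-ring

eval-σ₁-fromZ : ∀ t φ → eval (σW 1 (fromZ t)) φ ≡ eval (D t) (φ ∘ fromZ)
eval-σ₁-fromZ [] φ = refl
eval-σ₁-fromZ (k ∷ ks) φ =
  trans (eval-pre Y (word w ш word (X ∷ [])) φ)
    (trans (eval-bilin (λ u v → ofWords (shW u v)) (word w) (word (X ∷ [])) (φ ∘ (Y ∷_)))
      (trans (eval-word w (λ u → eval (word (X ∷ [])) (λ v → eval (ofWords (shW u v)) (φ ∘ (Y ∷_)))))
        (trans (eval-word (X ∷ []) (λ v → eval (ofWords (shW w v)) (φ ∘ (Y ∷_))))
          (trans (eval-ofWords (shW w (X ∷ [])) (φ ∘ (Y ∷_)))
            (trans (∑-shuffle-x ks k (φ ∘ (Y ∷_))) (sym (D-cons k ks (φ ∘ fromZ))))))))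
  where
  w : Word
  w = replicate k X ++ fromZ ks

eval-S₁W-X : ∀ w h → eval (S₁W (X ∷ w)) h ≡ eval (S₁W w) (h ∘ (X ∷_))
eval-S₁W-X w h =
  trans (eval-bilin (λ u v → word (u ++ v)) (word (X ∷ [])) (S₁W w) h)
    (trans (eval-word (X ∷ []) (λ u → eval (S₁W w) (λ v → eval (word (u ++ v)) h)))
      (eval-cong (S₁W w) (λ v → eval-word (X ∷ v) h)))

eval-S₁W-Y : ∀ w h → eval (S₁W (Y ∷ w)) h ≡ eval (S₁W w) (h ∘ (X ∷_)) + eval (S₁W w) (h ∘ (Y ∷_))
eval-S₁W-Y w h =
  trans (eval-bilin (λ u v → word (u ++ v)) (word (X ∷ []) ⊕ word (Y ∷ [])) (S₁W w) h)
    (trans (cong₂ _+_ (*-identityˡ onX) (trans (+-identityʳ (1ℚ * onY)) (*-identityˡ onY)))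
      (cong₂ _+_ (eval-cong (S₁W w) (λ v → eval-word (X ∷ v) h)) (eval-cong (S₁W w) (λ v → eval-word (Y ∷ v) h))))
  where
  onX onY : ℚ
  onX = eval (S₁W w) (λ v → eval (word (X ∷ v)) h)
  onY = eval (S₁W w) (λ v → eval (word (Y ∷ v)) h)

eval-S₁W-replicate : ∀ k w h → eval (S₁W (replicate k X ++ w)) h ≡ eval (S₁W w) (h ∘ (replicate k X ++_))
eval-S₁W-replicate zero w h = refl
eval-S₁W-replicate (suc k) w h =
  trans (eval-S₁W-X (replicate k X ++ w) h) (eval-S₁W-replicate k w (h ∘ (X ∷_)))

replicate-X-⊞ : ∀ k m (v : Word) → replicate k X ++ X ∷ replicate m X ++ v ≡ replicate (k ⊞ m) X ++ v
replicate-X-⊞ zero m v = refl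
replicate-X-⊞ (suc k) m v = cong (X ∷_) (replicate-X-⊞ k m v)

-- S₁ turns each inner y into x + y; choosing x merges two adjacent z-letters.
eval-S₁W-coarsenings : ∀ r k h →
  eval (S₁W (replicate k X ++ fromZ r)) (h ∘ (Y ∷_)) ≡ ∑ (coarseningsFrom k r) (h ∘ fromZ)
eval-S₁W-coarsenings [] k h =
  trans (eval-S₁W-replicate k [] (h ∘ (Y ∷_)))
    (trans (eval-word [] (λ v → h (Y ∷ replicate k X ++ v))) (sym (+-identityʳ (h (fromZ (k ∷ []))))))
eval-S₁W-coarsenings (m ∷ r) k h = begin
  eval (S₁W (replicate k X ++ Y ∷ w)) (h ∘ (Y ∷_))
    ≡⟨ eval-S₁W-replicate k (Y ∷ w) (h ∘ (Y ∷_)) ⟩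
  eval (S₁W (Y ∷ w)) (λ v → h (Y ∷ replicate k X ++ v))
    ≡⟨ eval-S₁W-Y w (λ v → h (Y ∷ replicate k X ++ v)) ⟩
  eval (S₁W w) (λ v → h (Y ∷ replicate k X ++ X ∷ v)) + eval (S₁W w) (λ v → h (Y ∷ replicate k X ++ Y ∷ v))
    ≡⟨ cong₂ _+_ merged separate ⟩
  ∑ (coarseningsFrom (k ⊞ m) r) (h ∘ fromZ) + ∑ (map (k ∷_) (coarseningsFrom m r)) (h ∘ fromZ)
    ≡⟨ +-comm (∑ (coarseningsFrom (k ⊞ m) r) (h ∘ fromZ)) _ ⟩
  ∑ (map (k ∷_) (coarseningsFrom m r)) (h ∘ fromZ) + ∑ (coarseningsFrom (k ⊞ m) r) (h ∘ fromZ)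
    ≡⟨ ∑-++ (map (k ∷_) (coarseningsFrom m r)) (coarseningsFrom (k ⊞ m) r) (h ∘ fromZ) ⟨
  ∑ (coarseningsFrom k (m ∷ r)) (h ∘ fromZ) ∎
  where
  w : Word
  w = replicate m X ++ fromZ r
  separate : eval (S₁W w) (λ v → h (Y ∷ replicate k X ++ Y ∷ v)) ≡ ∑ (map (k ∷_) (coarseningsFrom m r)) (h ∘ fromZ)
  separate = trans (eval-S₁W-coarsenings r m (λ v → h (Y ∷ replicate k X ++ v)))
                   (sym (∑-map (k ∷_) (coarseningsFrom m r) (h ∘ fromZ)))
  merged : eval (S₁W w) (λ v → h (Y ∷ replicate k X ++ X ∷ v)) ≡ ∑ (coarseningsFrom (k ⊞ m) r) (h ∘ fromZ)
  merged =
    trans (eval-S₁W-replicate m (fromZ r) (λ v → h (Y ∷ replicate k X ++ X ∷ v)))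
      (trans (eval-cong (S₁W (fromZ r)) (λ v → cong (λ z → h (Y ∷ z)) (replicate-X-⊞ k m v)))
        (trans (sym (eval-S₁W-replicate (k ⊞ m) (fromZ r) (h ∘ (Y ∷_)))) (eval-S₁W-coarsenings r (k ⊞ m) h)))

signW-fromZ : ∀ r → signW (fromZ r) ≡ sign r
signW-fromZ [] = refl
signW-fromZ (k ∷ r) = cong -_ (trans (signW-replicate k) (signW-fromZ r))
  where
  signW-replicate : ∀ k → signW (replicate k X ++ fromZ r) ≡ signW (fromZ r)
  signW-replicate zero = refl
  signW-replicate (suc k) = signW-replicate k

eval-S̃-fromZ : ∀ z φ → signW (fromZ z) * eval (SW (fromZ z)) φ ≡ eval (signedCoarsenings z) (φ ∘ fromZ)
eval-S̃-fromZ [] φ = *-identityˡ _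
eval-S̃-fromZ (k ∷ r) φ =
  trans (cong₂ _*_ (signW-fromZ (k ∷ r))
                   (trans (eval-pre Y (S₁W (replicate k X ++ fromZ r)) φ) (eval-S₁W-coarsenings r k φ)))
    (sym (eval-withCoeff (sign (k ∷ r)) (coarseningsFrom k r) (φ ∘ fromZ)))

eval-ψ-term : ∀ p q φ → eval (word (fromZ p) ∗ S̃ (σ 1 (word (fromZ (reverse q))))) φ ≡ antipode∘D q (harm (φ ∘ fromZ) p)
eval-ψ-term p q φ = begin
  eval (word (fromZ p) ∗ S̃ P) φ
    ≡⟨ eval-bilin harmW (word (fromZ p)) (S̃ P) φ ⟩
  eval (word (fromZ p)) (λ u → eval (S̃ P) (λ v → eval (harmW u v) φ))
    ≡⟨ eval-word (fromZ p) (λ u → eval (S̃ P) (λ v → eval (harmW u v) φ)) ⟩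
  eval (S (d P)) φₚ
    ≡⟨ eval-lin SW (d P) φₚ ⟩
  eval (d P) (λ w → eval (SW w) φₚ)
    ≡⟨ eval-d P (λ w → eval (SW w) φₚ) ⟩
  eval (lin (σW 1) (word (fromZ (reverse q)))) F
    ≡⟨ eval-lin (σW 1) (word (fromZ (reverse q))) F ⟩
  eval (word (fromZ (reverse q))) (λ w → eval (σW 1 w) F)
    ≡⟨ eval-word (fromZ (reverse q)) (λ w → eval (σW 1 w) F) ⟩
  eval (σW 1 (fromZ (reverse q))) F
    ≡⟨ eval-σ₁-fromZ (reverse q) F ⟩
  eval (D (reverse q)) (F ∘ fromZ)
    ≡⟨ eval-cong (D (reverse q)) (λ z → trans (eval-S̃-fromZ z φₚ)
                                               (eval-cong (signedCoarsenings z) (λ y → eval-harmW-fromZ p y φ))) ⟩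
  eval (D (reverse q)) (λ z → eval (signedCoarsenings z) (harm (φ ∘ fromZ) p))
    ≡⟨ D-reverse q (λ z → eval (signedCoarsenings z) (harm (φ ∘ fromZ) p)) ⟩
  antipode∘D q (harm (φ ∘ fromZ) p) ∎
  where
  P : Poly
  P = σ 1 (word (fromZ (reverse q)))
  φₚ F : Word → ℚ
  φₚ v = eval (harmW (fromZ p) v) φ
  F w = signW w * eval (SW w) φₚ

∑-upTo-splits : ∀ ks (F : ZWord → ZWord → ℚ) → ∑ (upTo (length ks)) (λ i → F (take i ks) (drop i ks)) ≡ Δ⁺ ks F
∑-upTo-splits [] F = refl
∑-upTo-splits (k ∷ w) F =
  cong (F [] (k ∷ w) +_)
    (trans (cong (λ L → ∑ L (λ i → F (take i (k ∷ w)) (drop i (k ∷ w)))) (sym (List.map-applyUpTo id suc (length w))))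
      (trans (∑-map suc (upTo (length w)) (λ i → F (take i (k ∷ w)) (drop i (k ∷ w))))
        (∑-upTo-splits w (F ∘ (k ∷_)))))

ψZ-eval : ∀ ks φ → eval (ψZ ks) φ ≡ Ψ ks (φ ∘ fromZ)
ψZ-eval ks φ =
  trans (eval-sumP (map term (upTo (length ks))) φ)
    (trans (∑-map term (upTo (length ks)) (λ P → eval P φ))
      (trans (∑-cong (upTo (length ks)) (λ i → eval-ψ-term (take i ks) (drop i ks) φ))
        (trans (∑-upTo-splits ks (λ p q → antipode∘D q (harm (φ ∘ fromZ) p)))
          (sym (trans (Δ-last ks (λ p q → antipode∘D q (harm (φ ∘ fromZ) p))) (+-identityʳ _))))))
  where
  term : ℕ → Poly
  term i = word (fromZ (take i ks)) ∗ S̃ (σ 1 (word (fromZ (reverse (drop i ks)))))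

ψ-harm-y-vanishes : ∀ u v φ → eval (harmW (Y ∷ u) (Y ∷ v)) (λ w → eval (ψW w) φ) ≡ 0ℚ
ψ-harm-y-vanishes u v φ with toZ' 0 u | toZ′-nonempty 0 u | toZ' 0 v | toZ′-nonempty 0 v
... | _ | k , a , refl | _ | l , b , refl =
  trans (eval-ofWords (map fromZ (harmZ (k ∷ a) (l ∷ b))) (λ w → eval (ψW w) φ))
    (trans (∑-map fromZ (harmZ (k ∷ a) (l ∷ b)) (λ w → eval (ψW w) φ))
      (trans (∑-cong (harmZ (k ∷ a) (l ∷ b)) (λ x → trans (cong (λ P → eval P φ) (ψW-fromZ x)) (ψZ-eval x φ)))
        (Ψ∘harm-vanishes k a l b (φ ∘ fromZ))))

ψ-generator-vanishes : ∀ c a b φ → eval (ψ (scale c (yP a ∗ yP b))) φ ≡ 0ℚ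
ψ-generator-vanishes c a b φ =
  trans (eval-lin ψW (scale c (yP a ∗ yP b)) φ)
    (trans (eval-scale c (yP a ∗ yP b) ψφ)
      (trans (cong (c *_) (trans (eval-bilin harmW (yP a) (yP b) ψφ)
               (trans (eval-pre Y a (λ u → eval (yP b) (λ v → eval (harmW u v) ψφ)))
                 (eval-vanish a (λ u → trans (eval-pre Y b (λ v → eval (harmW (Y ∷ u) v) ψφ))
                                             (eval-vanish b (λ v → ψ-harm-y-vanishes u v φ)))))))
        (*-zeroʳ c)))
  where
  ψφ : Word → ℚ
  ψφ w = eval (ψW w) φ

lemma7 : (gens : List (ℚ × Poly × Poly)) →
    IsZero (ψ (sumP (map (λ { (c , a , b) → scale c (yP a ∗ yP b) }) gens)))
lemma7 gens w =
  trans (coeff-eval (ψ (sumP generators)) w)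
    (trans (eval-lin ψW (sumP generators) (indicator w))
      (trans (eval-sumP generators ψφ)
        (trans (∑-map _ gens (λ P → eval P ψφ))
          (∑-vanish gens (λ { (c , a , b) → trans (sym (eval-lin ψW (scale c (yP a ∗ yP b)) (indicator w)))
                                                   (ψ-generator-vanishes c a b (indicator w)) })))))
  where
  generators : List Poly
  generators = map (λ { (c , a , b) → scale c (yP a ∗ yP b) }) gens
  ψφ : Word → ℚ
  ψφ v = eval (ψW v) (indicator w)
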